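{- Let $K$ be a finite simplicial complex and let $(C,\phi)$ be an AM-model for $K$. For each $q$ put $\pi_q=id_q-\phi_{q-1}\partial_q-\partial_{q+1}\phi_q:\mathcal{C}_q(K)\to\mathcal{C}_q(K)$, $\mathcal{M}_q=\operatorname{Im}\pi_q\subseteq \mathcal{C}_q(K)$ and $d_q=\partial_q|_{\mathcal{M}_q}$, and let $\mathcal{M}=(\mathcal{M},d)$. Define $f=\{f_q\}$ by $f_q=\pi_q:\mathcal{C}_q(K)\to\mathcal{M}_q$ and $g=\{g_q\}$ by letting $g_q:\mathcal{M}_q\to\mathcal{C}_q(K)$ be the inclusion. Then $(f,g,\phi)$ is a chain contraction of $\mathcal{C}(K)$ to the chain complex $\mathcal{M}$, and for each $q$ every non-null entry of the Smith normal form of the matrix of the differential $d_q$ of $\mathcal{M}$ is greater than $1$. In particular, if the integer homology of $K$ is free (torsion-free in every dimension), then $\mathcal{M}$ is isomorphic to the homology $\mathcal{H}(K)$ of $K$.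
   Context: For a finite simplicial complex $K$ with ordered vertex set, $\mathcal{C}(K)$ denotes its simplicial chain complex over $\mathbf{Z}$: $\mathcal{C}_q(K)$ is the free abelian group on the $q$-simplices, and $\partial_q\langle v_0,\dots,v_q\rangle=\sum_{i=0}^q(-1)^i\langle v_0,\dots,\hat v_i,\dots,v_q\rangle$ (with $\mathcal{C}_q(K)=0$ for $q<0$). Homology of $K$ means the integer homology of $\mathcal{C}(K)$. An AM-model for $K$ is a couple $(C,\phi)$ where $C=\{C_q\}$ with each $C_q$ a basis of $\mathcal{C}_q(K)$, and $\phi=\{\phi_q\}$ with $\phi_q:\mathcal{C}_q(K)\to\mathcal{C}_{q+1}(K)$ homomorphisms satisfying $\phi_{q+1}\phi_q=0$ and $\phi_q\partial_{q+1}\phi_q=\phi_q$ for all $q$, such that the chain complex $\mathcal{M}$ (with $\mathcal{M}_q=\operatorname{Im}\pi_q$, $\pi_q=id_q-\phi_{q-1}\partial_q-\partial_{q+1}\phi_q$, differential $d_q=\partial_q|_{\mathcal{M}_q}$) satisfies, for each $q$, that every non-null entry of the Smith normal form of $d_q$ is greater than $1$. A chain contraction $(f,g,\phi)$ of a chain complex $(\mathcal{C},d)$ to a chain complex $(\mathcal{C}',d')$ consists of homomorphisms $f_q:\mathcal{C}_q\to\mathcal{C}'_q$, $g_q:\mathcal{C}'_q\to\mathcal{C}_q$, $\phi_q:\mathcal{C}_q\to\mathcal{C}_{q+1}$ such that for all $q$: $f_{q-1}d_q=d'_qf_q$, $d_qg_q=g_{q-1}d'_q$, $f_qg_q=id_{\mathcal{C}'_q}$,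 and $\phi_{q-1}d_q+d_{q+1}\phi_q=id_q-g_qf_q$. -}

module Defs where

open import Data.Nat using (ℕ; zero; suc; _<ᵇ_) renaming (_+_ to _+ℕ_)
open import Data.Bool using (Bool; true; false; if_then_else_; _∧_)
open import Data.Integer using (ℤ; _+_; _-_; _*_; -_; _≤_; _<_; 0ℤ; 1ℤ)
open import Data.Integer.Divisibility using (_∣_)
open import Data.Fin using (Fin; zero; suc; toℕ; _≟_)
open import Data.Fin.Subset using (Subset; _⊆_; _∪_; ⁅_⁆; ∣_∣; Nonempty)
open import Data.Vec using (lookup)
open import Data.Product using (Σ; ∃; _×_)
open import Relation.Nullary using (¬_)
open import Relation.Nullary.Decidable using (⌊_⌋)
open import Relation.Binary.PropositionalEquality using (_≡_; _≢_)

sumℤ : ∀ {r} → (Fin r → ℤ) → ℤ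
sumℤ {zero}  a = 0ℤ
sumℤ {suc r} a = a zero + sumℤ (λ i → a (suc i))

sumℕ : ∀ {r} → (Fin r → ℕ) → ℕ
sumℕ {zero}  a = 0
sumℕ {suc r} a = a zero +ℕ sumℕ (λ i → a (suc i))

negPow : ℕ → ℤ
negPow zero    = 1ℤ
negPow (suc k) = - negPow k

-- Finite simplicial complexes on the ordered vertex set Fin n.
-- A simplex is a nonempty subset of Fin n; the ordering of vertices
-- is the ordering of Fin n.

record SimplicialComplex (n : ℕ) : Set where
  field
    IsSimplex  : Subset n → Bool
    nonempty   : ∀ σ → IsSimplex σ ≡ true → Nonempty σ
    downClosed : ∀ σ τ → IsSimplex σ ≡ true → τ ⊆ σ → Nonempty τ →
                 IsSimplex τ ≡ true

open SimplicialComplex public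

IsQSimplex : ∀ {n} → SimplicialComplex n → ℕ → Subset n → Set
IsQSimplex K q σ = (IsSimplex K σ ≡ true) × (∣ σ ∣ ≡ suc q)

-- An integer chain is a function from subsets of the vertex set
-- to ℤ (the coefficient of each simplex); equality is pointwise.
-- 𝒞_q(K) is the set of chains supported on the q-simplices of K,
-- i.e. the free abelian group on the q-simplices.

Chain : ℕ → Set
Chain n = Subset n → ℤ

_≈_ : ∀ {n} → Chain n → Chain n → Set
c ≈ c' = ∀ σ → c σ ≡ c' σ

0c : ∀ {n} → Chain n
0c σ = 0ℤ

_+c_ : ∀ {n} → Chain n → Chain n → Chain n
(c +c c') σ = c σ + c' σ

_-c_ : ∀ {n} → Chain n → Chain n → Chain n
(c -c c') σ = c σ - c' σ

_·c_ : ∀ {n} → ℤ → Chain n → Chain n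
(k ·c c) σ = k * c σ

IsChain : ∀ {n} → SimplicialComplex n → ℕ → Chain n → Set
IsChain K q c = ∀ σ → c σ ≢ 0ℤ → IsQSimplex K q σ

below : ∀ {n} → Subset n → Fin n → ℕ
below τ v = sumℕ (λ w → if lookup τ w ∧ (toℕ w <ᵇ toℕ v) then 1 else 0)

-- Boundary ∂_q : 𝒞_q → 𝒞_{q-1}, with ∂_0 = 0 (since 𝒞_{-1} = 0).
-- For q ≥ 1 the coefficient of τ in ∂c is  Σ_{v ∉ τ} (-1)^i c(τ ∪ {v}),
-- where i = position of v in the ordered simplex τ ∪ {v}; this is
-- exactly ∂⟨v_0,…,v_q⟩ = Σ_i (-1)^i ⟨v_0,…,v̂_i,…,v_q⟩.
bd : ∀ {n} → ℕ → Chain n → Chain n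
bd zero    c τ = 0ℤ
bd (suc q) c τ =
  sumℤ (λ v → if lookup τ v then 0ℤ else negPow (below τ v) * c (τ ∪ ⁅ v ⁆))

record IsHom {n} (P Q : Chain n → Set) (h : Chain n → Chain n) : Set where
  field
    maps     : ∀ c → P c → Q (h c)
    resp     : ∀ c c' → P c → P c' → c ≈ c' → h c ≈ h c'
    additive : ∀ c c' → P c → P c' → h (c +c c') ≈ (h c +c h c')

lc : ∀ {n r} → (Fin r → ℤ) → (Fin r → Chain n) → Chain n
lc a b σ = sumℤ (λ i → a i * b i σ)

record IsBasis {n r} (P : Chain n → Set) (b : Fin r → Chain n) : Set where
  field
    inP         : ∀ i → P (b i)
    independent : ∀ (a : Fin r → ℤ) → lc a b ≈ 0c → ∀ i → a i ≡ 0ℤ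
    spanning    : ∀ c → P c → ∃ λ (a : Fin r → ℤ) → c ≈ lc a b

Matrix : ℕ → ℕ → Set
Matrix m r = Fin m → Fin r → ℤ

_⊗_ : ∀ {m k r} → Matrix m k → Matrix k r → Matrix m r
(A ⊗ B) i j = sumℤ (λ l → A i l * B l j)

Id : ∀ {m} → Matrix m m
Id i j = if ⌊ i ≟ j ⌋ then 1ℤ else 0ℤ

_≈M_ : ∀ {m r} → Matrix m r → Matrix m r → Set
A ≈M B = ∀ i j → A i j ≡ B i j

Invertible : ∀ {m} → Matrix m m → Set
Invertible {m} P = Σ (Matrix m m) λ P' → ((P ⊗ P') ≈M Id) × ((P' ⊗ P) ≈M Id)

record IsSNFOf {m r} (A D : Matrix m r) : Set where
  field
    P    : Matrix m m
    Q    : Matrix r r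
    invP : Invertible P
    invQ : Invertible Q
    eq   : ((P ⊗ A) ⊗ Q) ≈M D
    diag : ∀ i j → toℕ i ≢ toℕ j → D i j ≡ 0ℤ
    nonneg : ∀ i j → 0ℤ ≤ D i j
    divChain : ∀ (i i' : Fin m) (j j' : Fin r) → toℕ i ≡ toℕ j → toℕ i' ≡ toℕ j' →
               toℕ i' ≡ suc (toℕ i) → D i j ∣ D i' j'

IsMatrixOf : ∀ {n m r} → (Chain n → Chain n) → (Fin r → Chain n) → (Fin m → Chain n) →
             Matrix m r → Set
IsMatrixOf d b b' A = ∀ j → d (b j) ≈ lc (λ i → A i j) b'

SNFCondition : ∀ {n} (P Q : Chain n → Set) → (Chain n → Chain n) → Set
SNFCondition {n} P Q d =
  ∀ {r m} (b : Fin r → Chain n) (b' : Fin m → Chain n) → IsBasis P b → IsBasis Q b' →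
  (A : Matrix m r) → IsMatrixOf d b b' A → (D : Matrix m r) → IsSNFOf A D →
  ∀ i j → D i j ≢ 0ℤ → 1ℤ < D i j

-- Chain complexes whose groups are subgroups of chains, ℕ-graded
-- (groups in negative degrees are 0).

record ChainCx (n : ℕ) : Set₁ where
  field
    Obj  : ℕ → Chain n → Set
    diff : ℕ → Chain n → Chain n      -- diff q : Obj q → Obj (q-1)

open ChainCx public

record IsChainCx {n} (A : ChainCx n) : Set where
  field
    diffHom : ∀ q → IsHom (Obj A (suc q)) (Obj A q) (diff A (suc q))
    dd      : ∀ q c → Obj A (suc (suc q)) c → diff A (suc q) (diff A (suc (suc q)) c) ≈ 0c

-- h_{q-1}, with h_{-1} = 0
prev : ∀ {n} → (ℕ → Chain n → Chain n) → ℕ → Chain n → Chain n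
prev h zero    c = 0c
prev h (suc q) c = h q c

record IsChainContraction {n} (A B : ChainCx n) (f g φ : ℕ → Chain n → Chain n) : Set where
  field
    fHom : ∀ q → IsHom (Obj A q) (Obj B q) (f q)
    gHom : ∀ q → IsHom (Obj B q) (Obj A q) (g q)
    φHom : ∀ q → IsHom (Obj A q) (Obj A (suc q)) (φ q)
    fd   : ∀ q c → Obj A (suc q) c → f q (diff A (suc q) c) ≈ diff B (suc q) (f (suc q) c)
    dg   : ∀ q x → Obj B (suc q) x → diff A (suc q) (g (suc q) x) ≈ g q (diff B (suc q) x)
    fg   : ∀ q x → Obj B q x → f q (g q x) ≈ x
    htpy : ∀ q c → Obj A q c →
           (prev φ q (diff A q c) +c diff A (suc q) (φ q c)) ≈ (c -c g q (f q c))

𝒞 : ∀ {n} → SimplicialComplex n → ChainCx n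
𝒞 K = record { Obj = IsChain K ; diff = bd }

π : ∀ {n} → (ℕ → Chain n → Chain n) → ℕ → Chain n → Chain n
π φ q c = (c -c prev φ q (bd q c)) -c bd (suc q) (φ q c)

InM : ∀ {n} → SimplicialComplex n → (ℕ → Chain n → Chain n) → ℕ → Chain n → Set
InM K φ q x = ∃ λ c → IsChain K q c × (x ≈ π φ q c)

𝓜 : ∀ {n} → SimplicialComplex n → (ℕ → Chain n → Chain n) → ChainCx n
𝓜 K φ = record { Obj = InM K φ ; diff = bd }

record IsAMModel {n} (K : SimplicialComplex n)
                 (C : ℕ → Σ ℕ λ r → Fin r → Chain n)
                 (φ : ℕ → Chain n → Chain n) : Set where
  field
    basisC : ∀ q → IsBasis (IsChain K q) (Data.Product.proj₂ (C q))
    φHom   : ∀ q → IsHom (IsChain K q) (IsChain K (suc q)) (φ q)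
    φφ     : ∀ q c → IsChain K q c → φ (suc q) (φ q c) ≈ 0c
    φ∂φ    : ∀ q c → IsChain K q c → φ q (bd (suc q) (φ q c)) ≈ φ q c
    snf    : ∀ q → SNFCondition (InM K φ (suc q)) (InM K φ q) (bd (suc q))

Cycle : ∀ {n} → SimplicialComplex n → ℕ → Chain n → Set
Cycle K q z = IsChain K q z × (bd q z ≈ 0c)

Bdry : ∀ {n} → SimplicialComplex n → ℕ → Chain n → Set
Bdry K q x = ∃ λ c → IsChain K (suc q) c × (x ≈ bd (suc q) c)

TorsionFreeHomology : ∀ {n} → SimplicialComplex n → Set
TorsionFreeHomology K =
  ∀ q z → Cycle K q z → ∀ (k : ℤ) → k ≢ 0ℤ → Bdry K q (k ·c z) → Bdry K q z

-- h = {h_q} is an isomorphism of chain complexes 𝓜 ≅ ℋ(K) (ℋ(K) with zero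
-- differential); h_q sends x ∈ A_q to (a representative cycle of) a class in H_q(K).
record IsHomologyIso {n} (K : SimplicialComplex n) (A : ChainCx n)
                     (h : ℕ → Chain n → Chain n) : Set where
  field
    toCycle  : ∀ q x → Obj A q x → Cycle K q (h q x)
    resp     : ∀ q x y → Obj A q x → Obj A q y → x ≈ y → Bdry K q (h q x -c h q y)
    additive : ∀ q x y → Obj A q x → Obj A q y →
               Bdry K q (h q (x +c y) -c (h q x +c h q y))
    chainMap : ∀ q x → Obj A (suc q) x → Bdry K q (h q (diff A (suc q) x))
    inj      : ∀ q x y → Obj A q x → Obj A q y → Bdry K q (h q x -c h q y) → x ≈ y
    surj     : ∀ q z → Cycle K q z → ∃ λ x → Obj A q x × Bdry K q (z -c h q x)

module Submission where

-- So 𝓜 = Im π is a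
--     subcomplex, π restricts to the identity on it, and the homotopy identity
--     φ∂ + ∂φ = id - π is the definition of π.
--
-- By the Smith normal form theorem (proved below by the
--     classical pivoting algorithm) the image of the endomorphism π of the free
--     module 𝒞_q(K) is free, so the SNF condition of the AM-model applies to
--     the differentials of 𝓜.  The first SNF entry δ of a matrix divides all of
--     its entries, so each differential of 𝓜 has image δ·(something), with
--     δ = 0 or δ > 1.  If H(K) is torsion-free, a boundary δz in 𝓜 forces z to
--     bound in K, hence in 𝓜; iterating, boundaries in 𝓜 are divisible by all
--     powers of δ, so the differentials vanish and 𝓜 ≅ H(K) via the identity.

open import Defs
open import Data.Nat using (ℕ; zero; suc; z≤n; s≤s; _<ᵇ_)
import Data.Nat as ℕ
import Data.Nat.Properties as ℕP
import Data.Nat.Divisibility as ℕD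
open import Data.Integer using (ℤ; 0ℤ; 1ℤ; _+_; _-_; _*_; -_; _^_; +_; -[1+_]; +[1+_]; ∣_∣; +≤+; +<+)
import Data.Integer as ℤ
open import Data.Integer.Properties
  using ( +-*-semiring; +-identityˡ; +-identityʳ; +-inverseˡ; +-inverseʳ; *-comm; *-assoc
        ; *-zeroˡ; *-zeroʳ; *-identityˡ; *-identityʳ; *-distribˡ-+; *-distribʳ-+; -1*i≡-i
        ; neg-distribˡ-*; abs-*; ∣i∣≡0⇒i≡0; i*j≡0⇒i≡0∨j≡0 )
open import Data.Integer.Tactic.RingSolver using (solve-∀)
open import Data.Integer.DivMod using (_/ℕ_; _%ℕ_; a≡a%ℕn+[a/ℕn]*n; n%ℕd<d)
open import Data.Integer.Divisibility using () renaming (_∣_ to _∣ᵤ_)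
open import Data.Integer.Divisibility.Signed
  using (_∣_; divides; _∣?_; ∣ᵤ⇒∣; ∣⇒∣ᵤ; ∣m∣n⇒∣m+n; ∣n⇒∣m*n; ∣m⇒∣m*n)
open import Algebra.Properties.Semiring.Sum +-*-semiring
  using (sum; sum-cong-≗; sum-replicate-zero; ∑-distrib-+; ∑-comm; *-distribˡ-sum)
open import Algebra.Properties.CommutativeSemigroup ℕP.+-commutativeSemigroup using (interchange)
open import Data.Bool using (Bool; true; false; if_then_else_; _∧_; _∨_; T)
import Data.Bool as Bool
open import Data.Bool.Properties using (∨-identityʳ; ∨-zeroʳ)
open import Data.Vec using ([]; _∷_; lookup; here; there)
open import Data.Vec.Properties using (lookup-zipWith)
open import Data.Fin using (Fin; zero; suc; _≟_; toℕ; inject≤; inject₁)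
open import Data.Fin.Properties using (all?; ¬∀⟶∃¬; toℕ-injective; toℕ-inject≤; toℕ-inject₁)
open import Data.Fin.Permutation.Components using (transpose; transpose-inverse)
open import Data.Fin.Subset using (Subset; _∪_; ⁅_⁆; Nonempty; ⊥) renaming (∣_∣ to ∣_∣ₛ)
open import Data.Fin.Subset.Properties using (p⊆p∪q; ∪-assoc; ∪-comm)
open import Data.Product using (Σ; ∃; _,_; _×_; proj₁; proj₂)
open import Data.Sum using (_⊎_; inj₁; inj₂; [_,_])
open import Data.Unit using (⊤; tt)
open import Data.Empty using (⊥-elim)
open import Relation.Nullary using (Dec; yes; no; ¬_)
open import Relation.Nullary.Decidable using (⌊_⌋)
open import Relation.Binary.Definitions using (tri<; tri≈; tri>)
open import Relation.Binary.Bundles using (Setoid)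
open import Level using (0ℓ)
import Relation.Binary.Reasoning.Setoid as SetoidReasoning
open import Relation.Binary.PropositionalEquality hiding (resp; [_])


-- The finite sum sumℤ agrees with the library's monoid sum;
-- through this bridge all algebraic laws of sums are taken from the library.
sumℤ≡sum : ∀ {r} (f : Fin r → ℤ) → sumℤ f ≡ sum f
sumℤ≡sum {zero}  f = refl
sumℤ≡sum {suc r} f = cong (_+_ (f zero)) (sumℤ≡sum (λ i → f (suc i)))

sumℤ-cong : ∀ {r} {f g : Fin r → ℤ} → (∀ i → f i ≡ g i) → sumℤ f ≡ sumℤ g
sumℤ-cong {f = f} {g} f≗g = trans (sumℤ≡sum f) (trans (sum-cong-≗ f≗g) (sym (sumℤ≡sum g)))

sumℤ-zero : ∀ {r} {f : Fin r → ℤ} → (∀ i → f i ≡ 0ℤ) → sumℤ f ≡ 0ℤ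
sumℤ-zero {r} f≗0 =
  trans (sumℤ-cong f≗0) (trans (sumℤ≡sum {r} (λ _ → 0ℤ)) (sum-replicate-zero r))

sumℤ-+ : ∀ {r} (f g : Fin r → ℤ) → sumℤ (λ i → f i + g i) ≡ sumℤ f + sumℤ g
sumℤ-+ f g = trans (sumℤ≡sum (λ i → f i + g i))
  (trans (∑-distrib-+ f g) (sym (cong₂ _+_ (sumℤ≡sum f) (sumℤ≡sum g))))

sumℤ-*ˡ : ∀ {r} (k : ℤ) (f : Fin r → ℤ) → sumℤ (λ i → k * f i) ≡ k * sumℤ f
sumℤ-*ˡ k f = trans (sumℤ≡sum (λ i → k * f i))
  (trans (sym (*-distribˡ-sum k f)) (cong (k *_) (sym (sumℤ≡sum f))))

sumℤ-*ʳ : ∀ {r} (k : ℤ) (f : Fin r → ℤ) → sumℤ (λ i → f i * k) ≡ sumℤ f * k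
sumℤ-*ʳ k f = trans (sumℤ-cong (λ i → *-comm (f i) k)) (trans (sumℤ-*ˡ k f) (*-comm k _))

sumℤ-neg : ∀ {r} (f : Fin r → ℤ) → sumℤ (λ i → - f i) ≡ - sumℤ f
sumℤ-neg f = trans (sumℤ-cong (λ i → sym (-1*i≡-i (f i))))
  (trans (sumℤ-*ˡ (- 1ℤ) f) (-1*i≡-i _))

sumℤ-swap : ∀ {r s} (f : Fin r → Fin s → ℤ) →
            sumℤ (λ i → sumℤ (f i)) ≡ sumℤ (λ j → sumℤ (λ i → f i j))
sumℤ-swap f = trans (double f) (trans (∑-comm f) (sym (double (λ j i → f i j))))
  where
  double : ∀ {r s} (g : Fin r → Fin s → ℤ) → sumℤ (λ i → sumℤ (g i)) ≡ sum (λ i → sum (g i))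
  double g = trans (sumℤ-cong (λ i → sumℤ≡sum (g i))) (sumℤ≡sum (λ i → sum (g i)))

Id-diag : ∀ {m} (i : Fin m) → Id i i ≡ 1ℤ
Id-diag i with i ≟ i
... | yes _ = refl
... | no i≢i = ⊥-elim (i≢i refl)

Id-sym : ∀ {m} (i j : Fin m) → Id i j ≡ Id j i
Id-sym i j with i ≟ j | j ≟ i
... | yes _   | yes _   = refl
... | no _    | no _    = refl
... | yes i≡j | no j≢i  = ⊥-elim (j≢i (sym i≡j))
... | no i≢j  | yes j≡i = ⊥-elim (i≢j (sym j≡i))

Id-suc : ∀ {m} (i j : Fin m) → Id (suc i) (suc j) ≡ Id i j
Id-suc i j with i ≟ j
... | yes _ = refl
... | no _  = refl

sum-Idˡ : ∀ {m} (a : Fin m) (f : Fin m → ℤ) → sumℤ (λ l → Id a l * f l) ≡ f a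
sum-Idˡ {suc m} zero f =
  trans (cong₂ _+_ (*-identityˡ (f zero)) (sumℤ-zero (λ l → *-zeroˡ (f (suc l)))))
        (+-identityʳ (f zero))
sum-Idˡ {suc m} (suc a) f =
  trans (+-identityˡ _)
    (trans (sumℤ-cong (λ l → cong (_* f (suc l)) (Id-suc a l))) (sum-Idˡ a (λ l → f (suc l))))

sum-Idʳ : ∀ {m} (a : Fin m) (f : Fin m → ℤ) → sumℤ (λ l → f l * Id l a) ≡ f a
sum-Idʳ a f = trans (sumℤ-cong (λ l → trans (*-comm (f l) _) (cong (_* f l) (Id-sym l a))))
                    (sum-Idˡ a f)

matrixSetoid : ℕ → ℕ → Setoid 0ℓ 0ℓ
matrixSetoid m r = record
  { Carrier       = Matrix m r
  ; _≈_           = _≈M_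
  ; isEquivalence = record
    { refl  = λ i j → refl
    ; sym   = λ e i j → sym (e i j)
    ; trans = λ e f i j → trans (e i j) (f i j) } }

module ≈M {m r : ℕ} = Setoid (matrixSetoid m r)
module ≈M-Reasoning {m r : ℕ} = SetoidReasoning (matrixSetoid m r)

⊗-cong : ∀ {m k r} {A A' : Matrix m k} {B B' : Matrix k r} →
         A ≈M A' → B ≈M B' → (A ⊗ B) ≈M (A' ⊗ B')
⊗-cong A≈ B≈ i j = sumℤ-cong (λ l → cong₂ _*_ (A≈ i l) (B≈ l j))

⊗-congˡ : ∀ {m k r} (A : Matrix m k) {B B' : Matrix k r} → B ≈M B' → (A ⊗ B) ≈M (A ⊗ B')
⊗-congˡ A = ⊗-cong {A = A} ≈M.refl

⊗-congʳ : ∀ {m k r} {A A' : Matrix m k} (B : Matrix k r) → A ≈M A' → (A ⊗ B) ≈M (A' ⊗ B)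
⊗-congʳ B A≈ = ⊗-cong A≈ (≈M.refl {x = B})

⊗-assoc : ∀ {m k l r} (A : Matrix m k) (B : Matrix k l) (C : Matrix l r) →
          ((A ⊗ B) ⊗ C) ≈M (A ⊗ (B ⊗ C))
⊗-assoc A B C i j = begin
  sumℤ (λ t → sumℤ (λ s → A i s * B s t) * C t j)
    ≡⟨ sumℤ-cong (λ t → sym (sumℤ-*ʳ (C t j) (λ s → A i s * B s t))) ⟩
  sumℤ (λ t → sumℤ (λ s → A i s * B s t * C t j))
    ≡⟨ sumℤ-swap (λ t s → A i s * B s t * C t j) ⟩
  sumℤ (λ s → sumℤ (λ t → A i s * B s t * C t j))
    ≡⟨ sumℤ-cong (λ s → trans (sumℤ-cong (λ t → *-assoc (A i s) (B s t) (C t j)))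
                              (sumℤ-*ˡ (A i s) (λ t → B s t * C t j))) ⟩
  sumℤ (λ s → A i s * sumℤ (λ t → B s t * C t j)) ∎
  where open ≡-Reasoning

Id-⊗ : ∀ {m r} (A : Matrix m r) → (Id ⊗ A) ≈M A
Id-⊗ A i j = sum-Idˡ i (λ l → A l j)

⊗-Id : ∀ {m r} (A : Matrix m r) → (A ⊗ Id) ≈M A
⊗-Id A i j = sum-Idʳ j (λ l → A i l)

cancel-middle : ∀ {m k l r} (A : Matrix m k) (B : Matrix k l) {B' : Matrix l k} (C : Matrix k r) →
                (B ⊗ B') ≈M Id → ((A ⊗ B) ⊗ (B' ⊗ C)) ≈M (A ⊗ C)
cancel-middle A B {B'} C BB'≈Id = begin
  (A ⊗ B) ⊗ (B' ⊗ C)   ≈⟨ ⊗-assoc A B (B' ⊗ C) ⟩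
  A ⊗ (B ⊗ (B' ⊗ C))   ≈⟨ ⊗-congˡ A (≈M.sym (⊗-assoc B B' C)) ⟩
  A ⊗ ((B ⊗ B') ⊗ C)   ≈⟨ ⊗-congˡ A (⊗-congʳ C BB'≈Id) ⟩
  A ⊗ (Id ⊗ C)         ≈⟨ ⊗-congˡ A (Id-⊗ C) ⟩
  A ⊗ C                ∎
  where open ≈M-Reasoning

Id-invertible : ∀ {m} → Invertible {m} Id
Id-invertible = Id , Id-⊗ Id , Id-⊗ Id

⊗-invertible : ∀ {m} {P Q : Matrix m m} → Invertible P → Invertible Q → Invertible (P ⊗ Q)
⊗-invertible {P = P} {Q} (P⁻¹ , PP⁻¹ , P⁻¹P) (Q⁻¹ , QQ⁻¹ , Q⁻¹Q) =
  Q⁻¹ ⊗ P⁻¹ ,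
  ≈M.trans (cancel-middle P Q P⁻¹ QQ⁻¹) PP⁻¹ ,
  ≈M.trans (cancel-middle Q⁻¹ P⁻¹ Q P⁻¹P) Q⁻¹Q

_ᵀ : ∀ {m r} → Matrix m r → Matrix r m
(A ᵀ) i j = A j i

infix 25 _ᵀ

⊗-ᵀ : ∀ {m k r} (A : Matrix m k) (B : Matrix k r) → ((A ⊗ B) ᵀ) ≈M ((B ᵀ) ⊗ (A ᵀ))
⊗-ᵀ A B i j = sumℤ-cong (λ l → *-comm (A j l) (B l i))

ᵀ-invertible : ∀ {m} {P : Matrix m m} → Invertible P → Invertible (P ᵀ)
ᵀ-invertible {P = P} (P⁻¹ , PP⁻¹ , P⁻¹P) = P⁻¹ ᵀ ,
  (λ i j → trans (sym (⊗-ᵀ P⁻¹ P i j)) (trans (P⁻¹P j i) (Id-sym j i))) ,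
  (λ i j → trans (sym (⊗-ᵀ P P⁻¹ i j)) (trans (PP⁻¹ j i) (Id-sym j i)))

record Equivalent {m r} (A B : Matrix m r) : Set where
  field
    P    : Matrix m m
    Q    : Matrix r r
    invP : Invertible P
    invQ : Invertible Q
    eq   : ((P ⊗ A) ⊗ Q) ≈M B

-- Equivalence of matrices is reflexive and transitive, and is preserved by
-- transposition (which turns column operations into row operations).
≈M⇒Equivalent : ∀ {m r} {A B : Matrix m r} → A ≈M B → Equivalent A B
≈M⇒Equivalent {A = A} A≈B = record
  { P = Id ; Q = Id ; invP = Id-invertible ; invQ = Id-invertible
  ; eq = ≈M.trans (⊗-Id (Id ⊗ A)) (≈M.trans (Id-⊗ A) A≈B) }

Equivalent-refl : ∀ {m r} {A : Matrix m r} → Equivalent A A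
Equivalent-refl = ≈M⇒Equivalent ≈M.refl

Equivalent-trans : ∀ {m r} {A B C : Matrix m r} → Equivalent A B → Equivalent B C → Equivalent A C
Equivalent-trans {A = A} {B} {C} A~B B~C = record
  { P = P₂ ⊗ P₁ ; Q = Q₁ ⊗ Q₂
  ; invP = ⊗-invertible (invP B~C) (invP A~B) ; invQ = ⊗-invertible (invQ A~B) (invQ B~C)
  ; eq = begin
      ((P₂ ⊗ P₁) ⊗ A) ⊗ (Q₁ ⊗ Q₂)   ≈⟨ ≈M.sym (⊗-assoc ((P₂ ⊗ P₁) ⊗ A) Q₁ Q₂) ⟩
      (((P₂ ⊗ P₁) ⊗ A) ⊗ Q₁) ⊗ Q₂   ≈⟨ ⊗-congʳ Q₂ (⊗-congʳ Q₁ (⊗-assoc P₂ P₁ A)) ⟩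
      ((P₂ ⊗ (P₁ ⊗ A)) ⊗ Q₁) ⊗ Q₂   ≈⟨ ⊗-congʳ Q₂ (⊗-assoc P₂ (P₁ ⊗ A) Q₁) ⟩
      (P₂ ⊗ ((P₁ ⊗ A) ⊗ Q₁)) ⊗ Q₂   ≈⟨ ⊗-congʳ Q₂ (⊗-congˡ P₂ (eq A~B)) ⟩
      (P₂ ⊗ B) ⊗ Q₂                 ≈⟨ eq B~C ⟩
      C                             ∎ }
  where
  open Equivalent
  open ≈M-Reasoning
  P₁ = P A~B ; Q₁ = Q A~B ; P₂ = P B~C ; Q₂ = Q B~C

Equivalent-ᵀ : ∀ {m r} {A B : Matrix m r} → Equivalent A B → Equivalent (A ᵀ) (B ᵀ)
Equivalent-ᵀ {A = A} {B} A~B = record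
  { P = Q ᵀ ; Q = P ᵀ ; invP = ᵀ-invertible invQ ; invQ = ᵀ-invertible invP
  ; eq = λ i j → begin
      ((Q ᵀ ⊗ A ᵀ) ⊗ P ᵀ) i j   ≡⟨ ⊗-assoc (Q ᵀ) (A ᵀ) (P ᵀ) i j ⟩
      (Q ᵀ ⊗ (A ᵀ ⊗ P ᵀ)) i j   ≡⟨ ⊗-congˡ (Q ᵀ) (λ a b → sym (⊗-ᵀ P A a b)) i j ⟩
      (Q ᵀ ⊗ (P ⊗ A) ᵀ) i j     ≡⟨ sym (⊗-ᵀ (P ⊗ A) Q i j) ⟩
      ((P ⊗ A) ⊗ Q) j i         ≡⟨ eq j i ⟩
      (B ᵀ) i j                 ∎ }
  where
  open Equivalent A~B
  open ≡-Reasoning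

row-operation : ∀ {m r} (E : Matrix m m) → Invertible E → {A B : Matrix m r} →
                (E ⊗ A) ≈M B → Equivalent A B
row-operation E invE {A} EA≈B = record
  { P = E ; Q = Id ; invP = invE ; invQ = Id-invertible ; eq = ≈M.trans (⊗-Id (E ⊗ A)) EA≈B }

all-or-counterexample : ∀ {n} (P : Fin n → Set) → (∀ i → Dec (P i)) →
                        (∃ λ i → ¬ P i) ⊎ (∀ i → P i)
all-or-counterexample P P? with all? P?
... | yes ∀P = inj₂ ∀P
... | no ¬∀P = inj₁ (¬∀⟶∃¬ _ P P? ¬∀P)

all-or-counterexample₂ : ∀ {m r} (P : Fin m → Fin r → Set) → (∀ i j → Dec (P i j)) →
                         (∃ λ i → ∃ λ j → ¬ P i j) ⊎ (∀ i j → P i j)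
all-or-counterexample₂ P P? with all-or-counterexample (λ i → ∀ j → P i j) (λ i → all? (P? i))
... | inj₂ ∀P = inj₂ ∀P
... | inj₁ (i , ¬∀P) = inj₁ (i , ¬∀⟶∃¬ _ (P i) (P? i) ¬∀P)

addRows : ∀ {m} → (Fin m → ℤ) → Fin m → Matrix m m
addRows u k a b = Id a b + u a * Id k b

addRows-⊗ : ∀ {m r} (u : Fin m → ℤ) k (B : Matrix m r) a j →
            (addRows u k ⊗ B) a j ≡ B a j + u a * B k j
addRows-⊗ u k B a j = begin
  sumℤ (λ l → (Id a l + u a * Id k l) * B l j)
    ≡⟨ sumℤ-cong (λ l → trans (*-distribʳ-+ (B l j) (Id a l) _)
                              (cong (_+_ (Id a l * B l j)) (*-assoc (u a) (Id k l) (B l j)))) ⟩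
  sumℤ (λ l → Id a l * B l j + u a * (Id k l * B l j))
    ≡⟨ sumℤ-+ (λ l → Id a l * B l j) (λ l → u a * (Id k l * B l j)) ⟩
  sumℤ (λ l → Id a l * B l j) + sumℤ (λ l → u a * (Id k l * B l j))
    ≡⟨ cong₂ _+_ (sum-Idˡ a (λ l → B l j))
                 (trans (sumℤ-*ˡ (u a) (λ l → Id k l * B l j)) (cong (u a *_) (sum-Idˡ k (λ l → B l j)))) ⟩
  B a j + u a * B k j ∎
  where open ≡-Reasoning

addRows-cancel : ∀ {m} (u v : Fin m → ℤ) k → (∀ a → u a + v a ≡ 0ℤ) → v k ≡ 0ℤ →
                 (addRows u k ⊗ addRows v k) ≈M Id
addRows-cancel u v k u+v≡0 vk≡0 a b = begin
  (addRows u k ⊗ addRows v k) a b               ≡⟨ addRows-⊗ u k (addRows v k) a b ⟩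
  Id a b + v a * Id k b + u a * (Id k b + v k * Id k b)
    ≡⟨ cong (λ w → Id a b + v a * Id k b + u a * (Id k b + w * Id k b)) vk≡0 ⟩
  Id a b + v a * Id k b + u a * (Id k b + 0ℤ * Id k b)
    ≡⟨ regroup (Id a b) (u a) (v a) (Id k b) ⟩
  Id a b + (u a + v a) * Id k b                 ≡⟨ cong (λ w → Id a b + w * Id k b) (u+v≡0 a) ⟩
  Id a b + 0ℤ * Id k b                          ≡⟨ +-identityʳ (Id a b) ⟩
  Id a b ∎
  where
  open ≡-Reasoning
  regroup : ∀ x u v z → x + v * z + u * (z + 0ℤ * z) ≡ x + (u + v) * z
  regroup = solve-∀

addRows-invertible : ∀ {m} (u : Fin m → ℤ) k → u k ≡ 0ℤ → Invertible (addRows u k)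
addRows-invertible u k uk≡0 = addRows (λ a → - u a) k ,
  addRows-cancel u (λ a → - u a) k (λ a → +-inverseʳ (u a)) (cong -_ uk≡0) ,
  addRows-cancel (λ a → - u a) u k (λ a → +-inverseˡ (u a)) uk≡0

permuteRows : ∀ {m} → (Fin m → Fin m) → Matrix m m
permuteRows σ a b = Id (σ a) b

permuteRows-⊗ : ∀ {m r} (σ : Fin m → Fin m) (B : Matrix m r) a j → (permuteRows σ ⊗ B) a j ≡ B (σ a) j
permuteRows-⊗ σ B a j = sum-Idˡ (σ a) (λ l → B l j)

swapRows-invertible : ∀ {m} (i j : Fin m) → Invertible (permuteRows (transpose i j))
swapRows-invertible i j = permuteRows (transpose j i) ,
  (λ a b → trans (permuteRows-⊗ (transpose i j) (permuteRows (transpose j i)) a b)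
                 (cong (λ x → Id x b) (transpose-inverse j i))) ,
  (λ a b → trans (permuteRows-⊗ (transpose j i) (permuteRows (transpose i j)) a b)
                 (cong (λ x → Id x b) (transpose-inverse i j)))

scaleRows : ∀ {m} → (Fin m → ℤ) → Matrix m m
scaleRows s a b = s a * Id a b

scaleRows-⊗ : ∀ {m r} (s : Fin m → ℤ) (B : Matrix m r) a j → (scaleRows s ⊗ B) a j ≡ s a * B a j
scaleRows-⊗ s B a j = trans (sumℤ-cong (λ l → *-assoc (s a) (Id a l) (B l j)))
  (trans (sumℤ-*ˡ (s a) (λ l → Id a l * B l j)) (cong (s a *_) (sum-Idˡ a (λ l → B l j))))

scaleRows-invertible : ∀ {m} (s : Fin m → ℤ) → (∀ a → s a * s a ≡ 1ℤ) → Invertible (scaleRows s)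
scaleRows-invertible s ss≡1 = scaleRows s , square≈Id , square≈Id
  where
  square≈Id : (scaleRows s ⊗ scaleRows s) ≈M Id
  square≈Id a b = trans (scaleRows-⊗ s (scaleRows s) a b)
    (trans (sym (*-assoc (s a) (s a) _)) (trans (cong (_* Id a b) (ss≡1 a)) (*-identityˡ _)))

unit-normalizer : ∀ x → Σ ℤ λ ε → (ε * ε ≡ 1ℤ) × (ε * x ≡ + ∣ x ∣)
unit-normalizer (+ n)    = 1ℤ , refl , *-identityˡ (+ n)
unit-normalizer -[1+ n ] = - 1ℤ , refl , -1*i≡-i -[1+ n ]

move-to-corner : ∀ {m r} (A : Matrix (suc m) (suc r)) i j →
                 Σ (Matrix (suc m) (suc r)) λ B → Equivalent A B × (B zero zero ≡ + ∣ A i j ∣)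
move-to-corner {m} A i j with unit-normalizer (A i j)
... | ε , εε≡1 , εA≡∣A∣ = B₃ , Equivalent-trans A~B₁ (Equivalent-trans B₁~B₂ B₂~B₃) , corner
  where
  B₁ = permuteRows (transpose zero i) ⊗ A
  A~B₁ : Equivalent A B₁
  A~B₁ = row-operation (permuteRows (transpose zero i)) (swapRows-invertible zero i) ≈M.refl
  B₂ᵀ = permuteRows (transpose zero j) ⊗ (B₁ ᵀ)
  B₁~B₂ : Equivalent B₁ (B₂ᵀ ᵀ)
  B₁~B₂ = Equivalent-ᵀ (row-operation (permuteRows (transpose zero j)) (swapRows-invertible zero j) ≈M.refl)
  s : Fin (suc m) → ℤ
  s zero    = ε
  s (suc _) = 1ℤ
  s-unit : ∀ a → s a * s a ≡ 1ℤ
  s-unit zero    = εε≡1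
  s-unit (suc a) = refl
  B₃ = scaleRows s ⊗ (B₂ᵀ ᵀ)
  B₂~B₃ : Equivalent (B₂ᵀ ᵀ) B₃
  B₂~B₃ = row-operation (scaleRows s) (scaleRows-invertible s s-unit) ≈M.refl
  corner : B₃ zero zero ≡ + ∣ A i j ∣
  corner = trans (scaleRows-⊗ s (B₂ᵀ ᵀ) zero zero)
    (trans (cong (ε *_) (trans (permuteRows-⊗ (transpose zero j) (B₁ ᵀ) zero zero)
                              (permuteRows-⊗ (transpose zero i) A zero j))) εA≡∣A∣)

SmallEntry : ∀ {m r} → Matrix m r → ℕ → Set
SmallEntry {m} {r} B n = Σ (Fin m) λ i → Σ (Fin r) λ j → (B i j ≢ 0ℤ) × (∣ B i j ∣ ℕ.≤ n)

SmallEntry-weaken : ∀ {m r} {B : Matrix m r} {k n} → k ℕ.≤ n → SmallEntry B k → SmallEntry B n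
SmallEntry-weaken k≤n (i , j , Bij≢0 , ∣Bij∣≤k) = i , j , Bij≢0 , ℕP.≤-trans ∣Bij∣≤k k≤n

SmallEntry-ᵀ : ∀ {m r} {B : Matrix m r} {n} → SmallEntry B n → SmallEntry (B ᵀ) n
SmallEntry-ᵀ (i , j , Bij≢0 , ∣Bij∣≤n) = j , i , Bij≢0 , ∣Bij∣≤n

-- Division with remainder by the corner pivot p = suc k: if p does not divide
-- the entry x in row a+1 of the first column, subtracting ⌊x/p⌋ times the
-- first row leaves a nonzero remainder of size < p there.
reduce-below : ∀ {m r} (B : Matrix (suc m) (suc r)) k → B zero zero ≡ + suc k → (a : Fin m) →
               ¬ (+ suc k ∣ B (suc a) zero) →
               Σ (Matrix (suc m) (suc r)) λ B' → Equivalent B B' × SmallEntry B' k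
reduce-below {m} B k corner a p∤x =
  B' , row-operation (addRows u zero) (addRows-invertible u zero refl) ≈M.refl ,
  suc a , zero , remainder≢0 , remainder≤k
  where
  x = B (suc a) zero
  q = x /ℕ suc k
  u : Fin (suc m) → ℤ
  u b = Id b (suc a) * (- q)
  B' = addRows u zero ⊗ B
  remainder : B' (suc a) zero ≡ + (x %ℕ suc k)
  remainder = begin
    B' (suc a) zero                                 ≡⟨ addRows-⊗ u zero B (suc a) zero ⟩
    x + Id (suc a) (suc a) * (- q) * B zero zero    ≡⟨ cong₂ (λ y z → x + y * (- q) * z) (Id-diag (suc a)) corner ⟩
    x + 1ℤ * (- q) * + suc k                        ≡⟨ cong (λ y → y + 1ℤ * (- q) * + suc k) (a≡a%ℕn+[a/ℕn]*n x (suc k)) ⟩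
    + (x %ℕ suc k) + q * + suc k + 1ℤ * (- q) * + suc k ≡⟨ cancel (+ (x %ℕ suc k)) q (+ suc k) ⟩
    + (x %ℕ suc k) ∎
    where
    open ≡-Reasoning
    cancel : ∀ r q d → r + q * d + 1ℤ * (- q) * d ≡ r
    cancel = solve-∀
  remainder≢0 : B' (suc a) zero ≢ 0ℤ
  remainder≢0 r≡0 = p∤x (divides q (trans (a≡a%ℕn+[a/ℕn]*n x (suc k))
    (trans (cong (_+ q * + suc k) (trans (sym remainder) r≡0)) (+-identityˡ _))))
  remainder≤k : ∣ B' (suc a) zero ∣ ℕ.≤ k
  remainder≤k = subst (λ y → ∣ y ∣ ℕ.≤ k) (sym remainder) (ℕP.≤-pred (n%ℕd<d x (suc k)))

record ColumnCleared {m r} (B B' : Matrix (suc m) (suc r)) (k : ℕ) : Set where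
  field
    equivalent   : Equivalent B B'
    corner       : B' zero zero ≡ + suc k
    column-clear : ∀ a → B' (suc a) zero ≡ 0ℤ
    row-kept     : ∀ j → B' zero j ≡ B zero j

clear-column : ∀ {m r} (B : Matrix (suc m) (suc r)) k → B zero zero ≡ + suc k →
               (∀ a → + suc k ∣ B (suc a) zero) → Σ (Matrix (suc m) (suc r)) λ B' → ColumnCleared B B' k
clear-column {m} B k corner p∣column = addRows u zero ⊗ B , record
  { equivalent   = row-operation (addRows u zero) (addRows-invertible u zero refl) ≈M.refl
  ; corner       = trans (addRows-⊗ u zero B zero zero) (trans (+-identityʳ _) corner)
  ; column-clear = λ a → trans (addRows-⊗ u zero B (suc a) zero) (cleared a)
  ; row-kept     = λ j → trans (addRows-⊗ u zero B zero j) (+-identityʳ _) }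
  where
  quotient : Fin m → ℤ
  quotient a = _∣_.quotient (p∣column a)
  u : Fin (suc m) → ℤ
  u zero    = 0ℤ
  u (suc a) = - quotient a
  cleared : ∀ a → B (suc a) zero + u (suc a) * B zero zero ≡ 0ℤ
  cleared a = trans (cong₂ (λ y z → y + (- quotient a) * z) (_∣_.equality (p∣column a)) corner)
                    (cancel (quotient a) (+ suc k))
    where
    cancel : ∀ q d → q * d + (- q) * d ≡ 0ℤ
    cancel = solve-∀

record Pivoted {m r} (B : Matrix (suc m) (suc r)) : Set where
  field
    k            : ℕ
    corner       : B zero zero ≡ + suc k
    row-clear    : ∀ j → B zero (suc j) ≡ 0ℤ
    column-clear : ∀ a → B (suc a) zero ≡ 0ℤ
    divides-rest : ∀ a j → + suc k ∣ B (suc a) (suc j)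

Pivoting : ∀ {m r} → Matrix (suc m) (suc r) → Set
Pivoting {m} {r} A = Σ (Matrix (suc m) (suc r)) λ B → Equivalent A B × Pivoted B

-- The induction hypothesis of the algorithm: the step can be carried out for
-- every matrix having a nonzero entry of size at most n.
Pivotable : ℕ → ℕ → ℕ → Set
Pivotable n m r = ∀ (X : Matrix (suc m) (suc r)) → SmallEntry X n → Pivoting X

via-smaller : ∀ {n m r} {A B : Matrix (suc m) (suc r)} {k} → Pivotable n m r → k ℕ.≤ n →
              Equivalent A B → SmallEntry B k → Pivoting A
via-smaller rec k≤n A~B small with rec _ (SmallEntry-weaken k≤n small)
... | C , B~C , pivoted = C , Equivalent-trans A~B B~C , pivoted

via-smallerᵀ : ∀ {n m r} {A B : Matrix (suc m) (suc r)} {C} {k} → Pivotable n m r → k ℕ.≤ n →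
               Equivalent A B → Equivalent (B ᵀ) C → SmallEntry C k → Pivoting A
via-smallerᵀ rec k≤n A~B Bᵀ~C small =
  via-smaller rec k≤n (Equivalent-trans A~B (Equivalent-ᵀ Bᵀ~C)) (SmallEntry-ᵀ small)

record Progress {m r} (A : Matrix (suc m) (suc r)) (n : ℕ) : Set where
  field
    B      : Matrix (suc m) (suc r)
    A~B    : Equivalent A B
    k      : ℕ
    k≤n    : k ℕ.≤ n
    corner : B zero zero ≡ + suc k

-- Either the pivot divides all
-- remaining entries, or adding the offending row to the first row produces a
-- first-row entry not divisible by the pivot, whose remainder is smaller.
finish : ∀ {n m r} {A : Matrix (suc m) (suc r)} → Pivotable n m r → (s : Progress A n) →
         let open Progress s in
         (∀ j → B zero (suc j) ≡ 0ℤ) → (∀ a → B (suc a) zero ≡ 0ℤ) → Pivoting A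
finish {m = m} rec s row-clear column-clear
  with all-or-counterexample₂ (λ a j → + suc (Progress.k s) ∣ Progress.B s (suc a) (suc j))
                              (λ a j → + suc (Progress.k s) ∣? Progress.B s (suc a) (suc j))
... | inj₂ p∣rest = B , A~B , record
  { k = k ; corner = corner ; row-clear = row-clear ; column-clear = column-clear ; divides-rest = p∣rest }
  where open Progress s
... | inj₁ (a , j , p∤Baj) =
  via-smallerᵀ rec k≤n (Equivalent-trans A~B B~C) (proj₁ (proj₂ reduced)) (proj₂ (proj₂ reduced))
  where
  open Progress s
  first : Fin (suc m) → ℤ
  first x = Id x zero
  C = addRows first (suc a) ⊗ B
  B~C : Equivalent B C
  B~C = row-operation (addRows first (suc a)) (addRows-invertible first (suc a) refl) ≈M.refl
  C-corner : C zero zero ≡ + suc k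
  C-corner = trans (addRows-⊗ first (suc a) B zero zero)
    (trans (cong₂ (λ y z → y + 1ℤ * z) corner (column-clear a)) (+-identityʳ _))
  p∤C0j : ¬ (+ suc k ∣ C zero (suc j))
  p∤C0j p∣ = p∤Baj (subst (+ suc k ∣_) (trans (addRows-⊗ first (suc a) B zero (suc j))
    (trans (cong (_+ 1ℤ * B (suc a) (suc j)) (row-clear j)) (trans (+-identityˡ _) (*-identityˡ _)))) p∣)
  reduced = reduce-below (C ᵀ) k C-corner j p∤C0j

-- Middle phase: the first column is clear; now treat the first row, by the
-- first phase applied to the transpose.
clear-row : ∀ {n m r} {A : Matrix (suc m) (suc r)} → Pivotable n m r → (s : Progress A n) →
            let open Progress s in (∀ a → B (suc a) zero ≡ 0ℤ) → Pivoting A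
clear-row {n} {A = A} rec s column-clear
  with all-or-counterexample (λ j → + suc (Progress.k s) ∣ Progress.B s zero (suc j))
                             (λ j → + suc (Progress.k s) ∣? Progress.B s zero (suc j))
... | inj₁ (j , p∤B0j) = via-smallerᵀ rec k≤n A~B (proj₁ (proj₂ reduced)) (proj₂ (proj₂ reduced))
  where
  open Progress s
  reduced = reduce-below (B ᵀ) k corner j p∤B0j
... | inj₂ p∣row = finish rec s′ (λ j → ColumnCleared.column-clear cleared j)
                              (λ a → trans (ColumnCleared.row-kept cleared (suc a)) (column-clear a))
  where
  open Progress s
  cleared = proj₂ (clear-column (B ᵀ) k corner p∣row)
  s′ : Progress A n
  s′ = record { B = proj₁ (clear-column (B ᵀ) k corner p∣row) ᵀ
              ; A~B = Equivalent-trans A~B (Equivalent-ᵀ (ColumnCleared.equivalent cleared))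
              ; k = k ; k≤n = k≤n ; corner = ColumnCleared.corner cleared }

-- First phase: make the pivot divide the first column (else recurse on a
-- smaller remainder), then clear the column.
clear-column-phase : ∀ {n m r} {A : Matrix (suc m) (suc r)} → Pivotable n m r → Progress A n → Pivoting A
clear-column-phase {n} {A = A} rec s
  with all-or-counterexample (λ a → + suc (Progress.k s) ∣ Progress.B s (suc a) zero)
                             (λ a → + suc (Progress.k s) ∣? Progress.B s (suc a) zero)
... | inj₁ (a , p∤Ba0) = via-smaller rec k≤n (Equivalent-trans A~B (proj₁ (proj₂ reduced))) (proj₂ (proj₂ reduced))
  where
  open Progress s
  reduced = reduce-below B k corner a p∤Ba0
... | inj₂ p∣column = clear-row rec s′ (ColumnCleared.column-clear cleared)
  where
  open Progress s
  cleared = proj₂ (clear-column B k corner p∣column)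
  s′ : Progress A n
  s′ = record { B = proj₁ (clear-column B k corner p∣column)
              ; A~B = Equivalent-trans A~B (ColumnCleared.equivalent cleared)
              ; k = k ; k≤n = k≤n ; corner = ColumnCleared.corner cleared }

-- Smith's algorithm terminates: by induction on the size of the smallest
-- nonzero entry, every matrix with a nonzero entry can be pivoted.
pivot : ∀ n {m r} → Pivotable n m r
pivot zero    A (i , j , Aij≢0 , ∣Aij∣≤0) = ⊥-elim (Aij≢0 (∣i∣≡0⇒i≡0 (ℕP.n≤0⇒n≡0 ∣Aij∣≤0)))
pivot (suc n) A (i , j , Aij≢0 , ∣Aij∣≤1+n) with ∣ A i j ∣ in ∣Aij∣≡
... | zero  = ⊥-elim (Aij≢0 (∣i∣≡0⇒i≡0 ∣Aij∣≡))
... | suc k = clear-column-phase (pivot n) record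
  { B = B ; A~B = A~B ; k = k ; k≤n = ℕP.≤-pred ∣Aij∣≤1+n ; corner = trans corner (cong +_ ∣Aij∣≡) }
  where
  moved = move-to-corner A i j
  B = proj₁ moved
  A~B = proj₁ (proj₂ moved)
  corner = proj₂ (proj₂ moved)

_∣M_ : ∀ {m r} → ℤ → Matrix m r → Set
p ∣M A = ∀ i j → p ∣ A i j

infix 4 _∣M_

∣-sumℤ : ∀ p {r} (f : Fin r → ℤ) → (∀ i → p ∣ f i) → p ∣ sumℤ f
∣-sumℤ p {zero}  f p∣f = divides 0ℤ refl
∣-sumℤ p {suc r} f p∣f = ∣m∣n⇒∣m+n (p∣f zero) (∣-sumℤ p (λ i → f (suc i)) (λ i → p∣f (suc i)))

∣M-⊗ʳ : ∀ {p m k r} (A : Matrix m k) {B : Matrix k r} → p ∣M B → p ∣M (A ⊗ B)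
∣M-⊗ʳ {p} A p∣B i j = ∣-sumℤ p _ (λ l → ∣n⇒∣m*n (A i l) (p∣B l j))

∣M-⊗ˡ : ∀ {p m k r} {A : Matrix m k} (B : Matrix k r) → p ∣M A → p ∣M (A ⊗ B)
∣M-⊗ˡ {p} B p∣A i j = ∣-sumℤ p _ (λ l → ∣m⇒∣m*n (B l j) (p∣A i l))

block : ∀ {m r} → ℤ → Matrix m r → Matrix (suc m) (suc r)
block x M zero    zero    = x
block x M zero    (suc j) = 0ℤ
block x M (suc i) zero    = 0ℤ
block x M (suc i) (suc j) = M i j

block-⊗ : ∀ {m k r} x y (M : Matrix m k) (N : Matrix k r) → (block x M ⊗ block y N) ≈M block (x * y) (M ⊗ N)
block-⊗ x y M N zero    zero    =
  trans (cong (_+_ (x * y)) (sumℤ-zero (λ l → *-zeroˡ (block y N (suc l) zero)))) (+-identityʳ _)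
block-⊗ x y M N zero    (suc j) = cong₂ _+_ (*-zeroʳ x) (sumℤ-zero (λ l → *-zeroˡ (N l j)))
block-⊗ x y M N (suc i) zero    = trans (+-identityˡ _) (sumℤ-zero (λ l → *-zeroʳ (M i l)))
block-⊗ x y M N (suc i) (suc j) = +-identityˡ _

block-cong : ∀ {m r} {x y} {M N : Matrix m r} → x ≡ y → M ≈M N → block x M ≈M block y N
block-cong x≡y M≈N zero    zero    = x≡y
block-cong x≡y M≈N zero    (suc j) = refl
block-cong x≡y M≈N (suc i) zero    = refl
block-cong x≡y M≈N (suc i) (suc j) = M≈N i j

block-Id : ∀ {m} → block 1ℤ (Id {m}) ≈M Id
block-Id zero    zero    = refl
block-Id zero    (suc j) = refl
block-Id (suc i) zero    = refl
block-Id (suc i) (suc j) = sym (Id-suc i j)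

block-invertible : ∀ {m} {P : Matrix m m} → Invertible P → Invertible (block 1ℤ P)
block-invertible {P = P} (P⁻¹ , PP⁻¹ , P⁻¹P) = block 1ℤ P⁻¹ ,
  ≈M.trans (block-⊗ 1ℤ 1ℤ P P⁻¹) (≈M.trans (block-cong refl PP⁻¹) block-Id) ,
  ≈M.trans (block-⊗ 1ℤ 1ℤ P⁻¹ P) (≈M.trans (block-cong refl P⁻¹P) block-Id)

Equivalent-block : ∀ {m r} x {M N : Matrix m r} → Equivalent M N → Equivalent (block x M) (block x N)
Equivalent-block x {M} M~N = record
  { P = block 1ℤ P ; Q = block 1ℤ Q ; invP = block-invertible invP ; invQ = block-invertible invQ
  ; eq = ≈M.trans (⊗-congʳ (block 1ℤ Q) (block-⊗ 1ℤ x P M))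
           (≈M.trans (block-⊗ (1ℤ * x) 1ℤ (P ⊗ M) Q)
                     (block-cong (trans (*-identityʳ _) (*-identityˡ x)) eq)) }
  where open Equivalent M~N

Pivoted⇒block : ∀ {m r} {B : Matrix (suc m) (suc r)} (pv : Pivoted B) →
                B ≈M block (+ suc (Pivoted.k pv)) (λ i j → B (suc i) (suc j))
Pivoted⇒block pv zero    zero    = Pivoted.corner pv
Pivoted⇒block pv zero    (suc j) = Pivoted.row-clear pv j
Pivoted⇒block pv (suc i) zero    = Pivoted.column-clear pv i
Pivoted⇒block pv (suc i) (suc j) = refl

SNFShape : ∀ {m r} → Matrix m r → Set
SNFShape {m} {r} D =
  (∀ i j → toℕ i ≢ toℕ j → D i j ≡ 0ℤ) × (∀ i j → 0ℤ ℤ.≤ D i j) ×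
  (∀ (i i' : Fin m) (j j' : Fin r) → toℕ i ≡ toℕ j → toℕ i' ≡ toℕ j' →
     toℕ i' ≡ suc (toℕ i) → D i j ∣ᵤ D i' j')

Equivalent⇒IsSNFOf : ∀ {m r} {A D : Matrix m r} → Equivalent A D → SNFShape D → IsSNFOf A D
Equivalent⇒IsSNFOf A~D (diagonal , nonneg , chain) = record
  { P = P ; Q = Q ; invP = invP ; invQ = invQ ; eq = eq ; diag = diagonal ; nonneg = nonneg ; divChain = chain }
  where open Equivalent A~D

IsSNFOf⇒Equivalent : ∀ {m r} {A D : Matrix m r} → IsSNFOf A D → Equivalent A D
IsSNFOf⇒Equivalent snf = record { P = P ; Q = Q ; invP = invP ; invQ = invQ ; eq = eq }
  where open IsSNFOf snf

zero-SNFShape : ∀ {m r} {A : Matrix m r} → (∀ i j → A i j ≡ 0ℤ) → SNFShape A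
zero-SNFShape A≡0 =
  (λ i j _ → A≡0 i j) ,
  (λ i j → subst (0ℤ ℤ.≤_) (sym (A≡0 i j)) (+≤+ z≤n)) ,
  (λ i i' j j' _ _ _ → subst₂ _∣ᵤ_ (sym (A≡0 i j)) (sym (A≡0 i' j')) (ℕD.divides 0 refl))

block-SNFShape : ∀ {m r} k {D : Matrix m r} → SNFShape D → + suc k ∣M D → SNFShape (block (+ suc k) D)
block-SNFShape k {D} (diagonal , nonneg , chain) p∣D = diagonal′ , nonneg′ , chain′
  where
  diagonal′ : ∀ i j → toℕ i ≢ toℕ j → block (+ suc k) D i j ≡ 0ℤ
  diagonal′ zero    zero    0≢0 = ⊥-elim (0≢0 refl)
  diagonal′ zero    (suc j) _   = refl
  diagonal′ (suc i) zero    _   = refl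
  diagonal′ (suc i) (suc j) i≢j = diagonal i j (λ i≡j → i≢j (cong suc i≡j))
  nonneg′ : ∀ i j → 0ℤ ℤ.≤ block (+ suc k) D i j
  nonneg′ zero    zero    = +≤+ z≤n
  nonneg′ zero    (suc j) = +≤+ z≤n
  nonneg′ (suc i) zero    = +≤+ z≤n
  nonneg′ (suc i) (suc j) = nonneg i j
  chain′ : ∀ i i' j j' → toℕ i ≡ toℕ j → toℕ i' ≡ toℕ j' → toℕ i' ≡ suc (toℕ i) →
           block (+ suc k) D i j ∣ᵤ block (+ suc k) D i' j'
  chain′ zero    (suc i') zero    (suc j') _  _  _  = ∣⇒∣ᵤ (p∣D i' j')
  chain′ zero    zero     _       _        _  _  ()
  chain′ zero    (suc i') (suc j) _        () _  _
  chain′ zero    (suc i') zero    zero     _  () _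
  chain′ (suc i) zero     _       _        _  _  ()
  chain′ (suc i) (suc i') zero    _        () _  _
  chain′ (suc i) (suc i') (suc j) zero     _  () _
  chain′ (suc i) (suc i') (suc j) (suc j') e₁ e₂ e₃ =
    chain i i' j j' (ℕP.suc-injective e₁) (ℕP.suc-injective e₂) (ℕP.suc-injective e₃)

-- Existence of the Smith normal form over ℤ: the zero matrix is already in
-- normal form; otherwise pivot, and recurse on the lower-right block, whose
-- entries (hence those of its normal form) are all divisible by the pivot.
smith-normal-form : ∀ m r (A : Matrix m r) → Σ (Matrix m r) λ D → IsSNFOf A D
smith-normal-form zero    r       A = A , Equivalent⇒IsSNFOf Equivalent-refl (zero-SNFShape (λ ()))
smith-normal-form (suc m) zero    A = A , Equivalent⇒IsSNFOf Equivalent-refl (zero-SNFShape (λ i ()))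
smith-normal-form (suc m) (suc r) A
  with all-or-counterexample₂ (λ i j → A i j ≡ 0ℤ) (λ i j → A i j ℤ.≟ 0ℤ)
... | inj₂ A≡0 = A , Equivalent⇒IsSNFOf Equivalent-refl (zero-SNFShape A≡0)
... | inj₁ (i , j , Aij≢0) with pivot (∣ A i j ∣) A (i , j , Aij≢0 , ℕP.≤-refl)
...   | B , A~B , pv with smith-normal-form m r (λ a b → B (suc a) (suc b))
...     | D′ , snf′ = block p D′ , Equivalent⇒IsSNFOf A~D
                        (block-SNFShape k (diag , nonneg , divChain) p∣D′)
  where
  open Pivoted pv using (k; divides-rest)
  open IsSNFOf snf′
  p = + suc k
  A~D : Equivalent A (block p D′)
  A~D = Equivalent-trans A~B (Equivalent-trans (≈M⇒Equivalent (Pivoted⇒block pv))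
                                               (Equivalent-block p (IsSNFOf⇒Equivalent snf′)))
  p∣D′ : p ∣M D′
  p∣D′ a b = subst (p ∣_) (eq a b) (∣M-⊗ˡ Q (∣M-⊗ʳ P divides-rest) a b)

IsSNFOf-recover : ∀ {m r} {A D : Matrix m r} (snf : IsSNFOf A D) →
                  A ≈M ((proj₁ (IsSNFOf.invP snf) ⊗ D) ⊗ proj₁ (IsSNFOf.invQ snf))
IsSNFOf-recover {A = A} {D} snf = ≈M.sym (begin
  (P⁻¹ ⊗ D) ⊗ Q⁻¹                  ≈⟨ ⊗-congʳ Q⁻¹ (⊗-congˡ P⁻¹ (≈M.sym eq)) ⟩
  (P⁻¹ ⊗ ((P ⊗ A) ⊗ Q)) ⊗ Q⁻¹      ≈⟨ ⊗-congʳ Q⁻¹ (≈M.sym (⊗-assoc P⁻¹ (P ⊗ A) Q)) ⟩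
  ((P⁻¹ ⊗ (P ⊗ A)) ⊗ Q) ⊗ Q⁻¹      ≈⟨ ⊗-assoc (P⁻¹ ⊗ (P ⊗ A)) Q Q⁻¹ ⟩
  (P⁻¹ ⊗ (P ⊗ A)) ⊗ (Q ⊗ Q⁻¹)      ≈⟨ ⊗-cong (≈M.sym (⊗-assoc P⁻¹ P A)) QQ⁻¹ ⟩
  ((P⁻¹ ⊗ P) ⊗ A) ⊗ Id             ≈⟨ ⊗-Id ((P⁻¹ ⊗ P) ⊗ A) ⟩
  (P⁻¹ ⊗ P) ⊗ A                    ≈⟨ ⊗-congʳ A P⁻¹P ⟩
  Id ⊗ A                           ≈⟨ Id-⊗ A ⟩
  A                                ∎)
  where
  open IsSNFOf snf
  open ≈M-Reasoning
  P⁻¹ = proj₁ invP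
  Q⁻¹ = proj₁ invQ
  P⁻¹P = proj₂ (proj₂ invP)
  QQ⁻¹ = proj₁ (proj₂ invQ)

-- The first diagonal entry of a Smith normal form divides every entry of D
-- (along the diagonal by the divisibility chain, off it trivially) ...
corner-divides-diagonal : ∀ {m r} {A D : Matrix (suc m) (suc r)} (snf : IsSNFOf A D) →
                          ∀ t (i : Fin (suc m)) (j : Fin (suc r)) → toℕ i ≡ t → toℕ i ≡ toℕ j →
                          D zero zero ∣ᵤ D i j
corner-divides-diagonal snf zero    zero    zero    _ _ = ℕD.∣-refl
corner-divides-diagonal snf zero    zero    (suc j) _ ()
corner-divides-diagonal snf zero    (suc i) j       () _
corner-divides-diagonal snf (suc t) zero    j       () _
corner-divides-diagonal snf (suc t) (suc i) zero    _ ()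
corner-divides-diagonal snf (suc t) (suc i) (suc j) i≡t i≡j =
  ℕD.∣-trans (corner-divides-diagonal snf t (inject₁ i) (inject₁ j)
                (trans (toℕ-inject₁ i) (ℕP.suc-injective i≡t)) previous-diagonal)
             (IsSNFOf.divChain snf (inject₁ i) (suc i) (inject₁ j) (suc j)
                previous-diagonal i≡j (cong suc (sym (toℕ-inject₁ i))))
  where
  previous-diagonal : toℕ (inject₁ i) ≡ toℕ (inject₁ j)
  previous-diagonal = trans (toℕ-inject₁ i) (trans (ℕP.suc-injective i≡j) (sym (toℕ-inject₁ j)))

corner-divides-SNF : ∀ {m r} {A D : Matrix (suc m) (suc r)} → IsSNFOf A D → D zero zero ∣M D
corner-divides-SNF {D = D} snf i j with toℕ i ℕ.≟ toℕ j
... | yes i≡j = ∣ᵤ⇒∣ (corner-divides-diagonal snf (toℕ i) i j refl i≡j)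
... | no  i≢j = divides 0ℤ (IsSNFOf.diag snf i j i≢j)

-- ... hence, as A = P⁻¹ D Q⁻¹, every entry of A: it is a gcd of the entries of A.
corner-divides : ∀ {m r} {A D : Matrix (suc m) (suc r)} → IsSNFOf A D → D zero zero ∣M A
corner-divides snf i j =
  subst (_ ∣_) (sym (IsSNFOf-recover snf i j))
        (∣M-⊗ˡ (proj₁ (IsSNFOf.invQ snf)) (∣M-⊗ʳ (proj₁ (IsSNFOf.invP snf)) (corner-divides-SNF snf)) i j)

≈-refl : ∀ {n} {c : Chain n} → c ≈ c
≈-refl σ = refl

≈-sym : ∀ {n} {c c' : Chain n} → c ≈ c' → c' ≈ c
≈-sym c≈c' σ = sym (c≈c' σ)

≈-trans : ∀ {n} {c c' c'' : Chain n} → c ≈ c' → c' ≈ c'' → c ≈ c''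
≈-trans c≈c' c'≈c'' σ = trans (c≈c' σ) (c'≈c'' σ)

-c_ : ∀ {n} → Chain n → Chain n
(-c c) σ = - c σ

record Submodule {n} (P : Chain n → Set) : Set where
  field
    P-0 : P 0c
    P-+ : ∀ {c c'} → P c → P c' → P (c +c c')
    P-· : ∀ k {c} → P c → P (k ·c c)
    P-≈ : ∀ {c c'} → c ≈ c' → P c → P c'

  P-neg : ∀ {c} → P c → P (-c c)
  P-neg {c} Pc = P-≈ (λ σ → -1*i≡-i (c σ)) (P-· (- 1ℤ) Pc)

  P-- : ∀ {c c'} → P c → P c' → P (c -c c')
  P-- Pc Pc' = P-+ Pc (P-neg Pc')

  P-lc : ∀ {r} (a : Fin r → ℤ) (b : Fin r → Chain n) → (∀ i → P (b i)) → P (lc a b)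
  P-lc {zero}  a b Pb = P-0
  P-lc {suc r} a b Pb = P-+ (P-· (a zero) (Pb zero)) (P-lc (λ i → a (suc i)) (λ i → b (suc i)) (λ i → Pb (suc i)))

open Submodule public

all-chains : ∀ {n} → Submodule {n} (λ _ → ⊤)
all-chains = record { P-0 = tt ; P-+ = λ _ _ → tt ; P-· = λ _ _ → tt ; P-≈ = λ _ _ → tt }

nonzero-sum : ∀ x y → x + y ≢ 0ℤ → x ≢ 0ℤ ⊎ y ≢ 0ℤ
nonzero-sum x y x+y≢0 with x ℤ.≟ 0ℤ
... | no  x≢0  = inj₁ x≢0
... | yes refl = inj₂ (λ y≡0 → x+y≢0 (trans (+-identityˡ y) y≡0))

chains : ∀ {n} (K : SimplicialComplex n) q → Submodule (IsChain K q)
chains K q = record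
  { P-0 = λ σ 0≢0 → ⊥-elim (0≢0 refl)
  ; P-+ = λ {c} {c'} Kc Kc' σ ≢0 → [ Kc σ , Kc' σ ] (nonzero-sum (c σ) (c' σ) ≢0)
  ; P-· = λ k Kc σ ≢0 → Kc σ (λ cσ≡0 → ≢0 (trans (cong (k *_) cσ≡0) (*-zeroʳ k)))
  ; P-≈ = λ c≈c' Kc σ ≢0 → Kc σ (λ cσ≡0 → ≢0 (trans (sym (c≈c' σ)) cσ≡0)) }

lc-cong : ∀ {n r} {a a' : Fin r → ℤ} (b : Fin r → Chain n) → (∀ i → a i ≡ a' i) → lc a b ≈ lc a' b
lc-cong b a≡a' σ = sumℤ-cong (λ i → cong (_* b i σ) (a≡a' i))

lc-scale : ∀ {n r} (δ : ℤ) (t : Fin r → ℤ) (b : Fin r → Chain n) → lc (λ i → δ * t i) b ≈ (δ ·c lc t b)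
lc-scale δ t b σ = trans (sumℤ-cong (λ i → *-assoc δ (t i) (b i σ)))
                         (sumℤ-*ˡ δ (λ i → t i * b i σ))

module Linear {n} {P Q : Chain n → Set} (SP : Submodule P) (SQ : Submodule Q)
              {h : Chain n → Chain n} (H : IsHom P Q h) where
  open IsHom H

  h-0 : h 0c ≈ 0c
  h-0 σ = idempotent⇒0 (h 0c σ) (additive 0c 0c (P-0 SP) (P-0 SP) σ)
    where
    idempotent⇒0 : ∀ x → x ≡ x + x → x ≡ 0ℤ
    idempotent⇒0 x x≡x+x =
      trans (sym (x+x-x≡x x)) (trans (cong (λ y → y - x) (sym x≡x+x)) (+-inverseʳ x))
      where
      x+x-x≡x : ∀ x → x + x - x ≡ x
      x+x-x≡x = solve-∀

  h-resp-0 : ∀ {c} → P c → c ≈ 0c → h c ≈ 0c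
  h-resp-0 Pc c≈0 = ≈-trans (resp _ _ Pc (P-0 SP) c≈0) h-0

  h-neg : ∀ {c} → P c → h (-c c) ≈ (-c h c)
  h-neg {c} Pc σ = sum≡0 (h c σ) (h (-c c) σ)
    (trans (sym (additive c (-c c) Pc (P-neg SP Pc) σ)) (h-resp-0 (P-+ SP Pc (P-neg SP Pc)) (λ τ → +-inverseʳ (c τ)) σ))
    where
    sum≡0 : ∀ a b → a + b ≡ 0ℤ → b ≡ - a
    sum≡0 a b a+b≡0 = trans (sym (solve' a b)) (trans (cong (_+_ (- a)) a+b≡0) (+-identityʳ (- a)))
      where
      solve' : ∀ a b → - a + (a + b) ≡ b
      solve' = solve-∀

  h-- : ∀ {c c'} → P c → P c' → h (c -c c') ≈ (h c -c h c')
  h-- Pc Pc' σ = trans (additive _ _ Pc (P-neg SP Pc') σ) (cong (_+_ (h _ σ)) (h-neg Pc' σ))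

  h-·ℕ : ∀ m {c} → P c → h ((+ m) ·c c) ≈ ((+ m) ·c h c)
  h-·ℕ zero    Pc = h-resp-0 (P-· SP (+ 0) Pc) (λ σ → refl)
  h-·ℕ (suc m) {c} Pc σ = begin
    h (+[1+ m ] ·c c) σ         ≡⟨ resp (+[1+ m ] ·c c) (c +c ((+ m) ·c c)) (P-· SP +[1+ m ] Pc) (P-+ SP Pc (P-· SP (+ m) Pc))
                                      (λ τ → 1+m· (c τ)) σ ⟩
    h (c +c ((+ m) ·c c)) σ       ≡⟨ additive c _ Pc (P-· SP (+ m) Pc) σ ⟩
    h c σ + h ((+ m) ·c c) σ      ≡⟨ cong (_+_ (h c σ)) (h-·ℕ m Pc σ) ⟩
    h c σ + + m * h c σ         ≡⟨ sym (1+m· (h c σ)) ⟩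
    +[1+ m ] * h c σ            ∎
    where
    open ≡-Reasoning
    1+m· : ∀ x → +[1+ m ] * x ≡ x + + m * x
    1+m· x = trans (*-distribʳ-+ x 1ℤ (+ m)) (cong (_+ + m * x) (*-identityˡ x))

  h-· : ∀ k {c} → P c → h (k ·c c) ≈ (k ·c h c)
  h-· (+ m)    Pc = h-·ℕ m Pc
  h-· -[1+ m ] {c} Pc σ = begin
    h (-[1+ m ] ·c c) σ            ≡⟨ resp (-[1+ m ] ·c c) (-c (+[1+ m ] ·c c)) (P-· SP -[1+ m ] Pc) (P-neg SP (P-· SP +[1+ m ] Pc))
                                         (λ τ → neg· (c τ)) σ ⟩
    h (-c (+[1+ m ] ·c c)) σ       ≡⟨ h-neg (P-· SP +[1+ m ] Pc) σ ⟩
    - h (+[1+ m ] ·c c) σ          ≡⟨ cong -_ (h-·ℕ (suc m) Pc σ) ⟩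
    - (+[1+ m ] * h c σ)           ≡⟨ sym (neg· (h c σ)) ⟩
    -[1+ m ] * h c σ               ∎
    where
    open ≡-Reasoning
    neg· : ∀ x → -[1+ m ] * x ≡ - (+[1+ m ] * x)
    neg· x = sym (neg-distribˡ-* +[1+ m ] x)

  h-lc : ∀ {r} (a : Fin r → ℤ) (b : Fin r → Chain n) → (∀ i → P (b i)) → h (lc a b) ≈ lc a (λ i → h (b i))
  h-lc {zero}  a b Pb = h-0
  h-lc {suc r} a b Pb σ =
    trans (additive _ _ (P-· SP (a zero) (Pb zero)) (P-lc SP (λ i → a (suc i)) (λ i → b (suc i)) (λ i → Pb (suc i))) σ)
          (cong₂ _+_ (h-· (a zero) (Pb zero) σ) (h-lc (λ i → a (suc i)) (λ i → b (suc i)) (λ i → Pb (suc i)) σ))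

hom-∘ : ∀ {n} {P Q R : Chain n → Set} → Submodule P → Submodule Q → ∀ {h h'} →
        IsHom P Q h → IsHom Q R h' → IsHom P R (λ c → h' (h c))
hom-∘ SP SQ H H' = record
  { maps     = λ c Pc → IsHom.maps H' _ (IsHom.maps H c Pc)
  ; resp     = λ c c' Pc Pc' c≈c' →
      IsHom.resp H' _ _ (IsHom.maps H c Pc) (IsHom.maps H c' Pc') (IsHom.resp H c c' Pc Pc' c≈c')
  ; additive = λ c c' Pc Pc' → ≈-trans
      (IsHom.resp H' _ _ (IsHom.maps H _ (P-+ SP Pc Pc')) (P-+ SQ (IsHom.maps H c Pc) (IsHom.maps H c' Pc'))
                  (IsHom.additive H c c' Pc Pc'))
      (IsHom.additive H' _ _ (IsHom.maps H c Pc) (IsHom.maps H c' Pc')) }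

hom-- : ∀ {n} {P Q : Chain n → Set} → Submodule Q → ∀ {h h'} →
        IsHom P Q h → IsHom P Q h' → IsHom P Q (λ c → h c -c h' c)
hom-- SQ {h} {h'} H H' = record
  { maps     = λ c Pc → P-- SQ (IsHom.maps H c Pc) (IsHom.maps H' c Pc)
  ; resp     = λ c c' Pc Pc' c≈c' σ → cong₂ _-_ (IsHom.resp H c c' Pc Pc' c≈c' σ) (IsHom.resp H' c c' Pc Pc' c≈c' σ)
  ; additive = λ c c' Pc Pc' σ →
      trans (cong₂ _-_ (IsHom.additive H c c' Pc Pc' σ) (IsHom.additive H' c c' Pc Pc' σ))
            (regroup (h c σ) (h c' σ) (h' c σ) (h' c' σ)) }
  where
  regroup : ∀ a b x y → a + b - (x + y) ≡ a - x + (b - y)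
  regroup = solve-∀

hom-id : ∀ {n} {P : Chain n → Set} → IsHom P P (λ c → c)
hom-id = record { maps = λ c Pc → Pc ; resp = λ _ _ _ _ c≈c' → c≈c' ; additive = λ _ _ _ _ σ → refl }

hom-0 : ∀ {n} {P Q : Chain n → Set} → Submodule Q → IsHom P Q (λ c → 0c)
hom-0 SQ = record { maps = λ _ _ → P-0 SQ ; resp = λ _ _ _ _ _ σ → refl ; additive = λ _ _ _ _ σ → refl }

coface : ∀ {n} → Chain n → Subset n → Fin n → ℤ
coface c τ v = if lookup τ v then 0ℤ else negPow (below τ v) * c (τ ∪ ⁅ v ⁆)

bd-resp : ∀ {n} q {c c' : Chain n} → c ≈ c' → bd q c ≈ bd q c'
bd-resp zero    c≈c' τ = refl
bd-resp (suc q) {c} {c'} c≈c' τ = sumℤ-cong (λ v → face (lookup τ v))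
  where
  face : ∀ b {v} → (if b then 0ℤ else negPow (below τ v) * c (τ ∪ ⁅ v ⁆)) ≡
                   (if b then 0ℤ else negPow (below τ v) * c' (τ ∪ ⁅ v ⁆))
  face true        = refl
  face false {v}   = cong (negPow (below τ v) *_) (c≈c' (τ ∪ ⁅ v ⁆))

bd-+ : ∀ {n} q (c c' : Chain n) → bd q (c +c c') ≈ (bd q c +c bd q c')
bd-+ zero    c c' τ = refl
bd-+ (suc q) c c' τ = trans (sumℤ-cong (λ v → face (lookup τ v))) (sumℤ-+ (coface c τ) (coface c' τ))
  where
  face : ∀ b {v} → (if b then 0ℤ else negPow (below τ v) * (c (τ ∪ ⁅ v ⁆) + c' (τ ∪ ⁅ v ⁆))) ≡
                   (if b then 0ℤ else negPow (below τ v) * c (τ ∪ ⁅ v ⁆)) +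
                   (if b then 0ℤ else negPow (below τ v) * c' (τ ∪ ⁅ v ⁆))
  face true      = refl
  face false {v} = *-distribˡ-+ (negPow (below τ v)) (c (τ ∪ ⁅ v ⁆)) (c' (τ ∪ ⁅ v ⁆))

bd-hom : ∀ {n} q → IsHom {n} (λ _ → ⊤) (λ _ → ⊤) (bd q)
bd-hom q = record { maps = λ _ _ → tt ; resp = λ _ _ _ _ → bd-resp q ; additive = λ c c' _ _ → bd-+ q c c' }

module BdLinear {n} q = Linear {n} all-chains all-chains (bd-hom q)

lookup-⁅⁆ : ∀ {n} (v u : Fin n) → lookup ⁅ v ⁆ u ≡ ⌊ u ≟ v ⌋
lookup-⁅⁆ zero    zero    = refl
lookup-⁅⁆ zero    (suc u) = lookup-⊥ u
  where
  lookup-⊥ : ∀ {n} (u : Fin n) → lookup (⊥ {n}) u ≡ false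
  lookup-⊥ zero    = refl
  lookup-⊥ (suc u) = lookup-⊥ u
lookup-⁅⁆ (suc v) zero    = refl
lookup-⁅⁆ (suc v) (suc u) with u ≟ v | lookup-⁅⁆ v u
... | yes _ | eq = eq
... | no _  | eq = eq

lookup-∪⁅⁆ : ∀ {n} (ρ : Subset n) (v u : Fin n) → lookup (ρ ∪ ⁅ v ⁆) u ≡ (lookup ρ u ∨ ⌊ u ≟ v ⌋)
lookup-∪⁅⁆ ρ v u = trans (lookup-zipWith _∨_ u ρ ⁅ v ⁆) (cong (lookup ρ u ∨_) (lookup-⁅⁆ v u))

⌊≟⌋-refl : ∀ {n} (v : Fin n) → ⌊ v ≟ v ⌋ ≡ true
⌊≟⌋-refl v with v ≟ v
... | yes _   = refl
... | no v≢v  = ⊥-elim (v≢v refl)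

⌊≟⌋-distinct : ∀ {n} {v w : Fin n} → w ≢ v → ⌊ w ≟ v ⌋ ≡ false
⌊≟⌋-distinct {v = v} {w} w≢v with w ≟ v
... | yes w≡v = ⊥-elim (w≢v w≡v)
... | no _    = refl

∉-∪⁅⁆ : ∀ {n} (ρ : Subset n) {v w : Fin n} → lookup ρ w ≡ false → w ≢ v → lookup (ρ ∪ ⁅ v ⁆) w ≡ false
∉-∪⁅⁆ ρ {v} {w} w∉ρ w≢v = trans (lookup-∪⁅⁆ ρ v w) (cong₂ _∨_ w∉ρ (⌊≟⌋-distinct w≢v))

∪⁅⁆-comm : ∀ {n} (ρ : Subset n) v w → (ρ ∪ ⁅ v ⁆) ∪ ⁅ w ⁆ ≡ (ρ ∪ ⁅ w ⁆) ∪ ⁅ v ⁆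
∪⁅⁆-comm ρ v w = trans (∪-assoc ρ ⁅ v ⁆ ⁅ w ⁆) (trans (cong (ρ ∪_) (∪-comm ⁅ v ⁆ ⁅ w ⁆)) (sym (∪-assoc ρ ⁅ w ⁆ ⁅ v ⁆)))

∣∪⁅⁆∣ : ∀ {n} (ρ : Subset n) (v : Fin n) → lookup ρ v ≡ false → ∣ ρ ∪ ⁅ v ⁆ ∣ₛ ≡ suc ∣ ρ ∣ₛ
∣∪⁅⁆∣ (false ∷ ρ) zero    _   = cong (λ x → suc ∣ x ∣ₛ) (∪-⊥ ρ)
  where
  ∪-⊥ : ∀ {n} (p : Subset n) → p ∪ ⊥ ≡ p
  ∪-⊥ []      = refl
  ∪-⊥ (x ∷ p) = cong₂ _∷_ (∨-identityʳ x) (∪-⊥ p)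
∣∪⁅⁆∣ (true ∷ ρ)  (suc v) v∉ρ = cong suc (∣∪⁅⁆∣ ρ v v∉ρ)
∣∪⁅⁆∣ (false ∷ ρ) (suc v) v∉ρ = ∣∪⁅⁆∣ ρ v v∉ρ

nonempty-of-size : ∀ {n} (ρ : Subset n) q → ∣ ρ ∣ₛ ≡ suc q → Nonempty ρ
nonempty-of-size (true ∷ ρ)  q _ = zero , here
nonempty-of-size (false ∷ ρ) q ∣ρ∣≡ with nonempty-of-size ρ q ∣ρ∣≡
... | x , x∈ρ = suc x , there x∈ρ

[_<_] : ∀ {n} → Fin n → Fin n → ℕ
[ v < w ] = if toℕ v <ᵇ toℕ w then 1 else 0

sumℕ-cong : ∀ {r} {f g : Fin r → ℕ} → (∀ i → f i ≡ g i) → sumℕ f ≡ sumℕ g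
sumℕ-cong {zero}  f≗g = refl
sumℕ-cong {suc r} f≗g = cong₂ ℕ._+_ (f≗g zero) (sumℕ-cong (λ i → f≗g (suc i)))

sumℕ-+ : ∀ {r} (f g : Fin r → ℕ) → sumℕ (λ i → f i ℕ.+ g i) ≡ sumℕ f ℕ.+ sumℕ g
sumℕ-+ {zero}  f g = refl
sumℕ-+ {suc r} f g = trans (cong (f zero ℕ.+ g zero ℕ.+_) (sumℕ-+ (λ i → f (suc i)) (λ i → g (suc i))))
                           (interchange (f zero) (g zero) (sumℕ (λ i → f (suc i))) (sumℕ (λ i → g (suc i))))

sumℕ-indicator : ∀ {r} (v : Fin r) (k : ℕ) → sumℕ (λ u → if ⌊ u ≟ v ⌋ then k else 0) ≡ k
sumℕ-indicator {suc r} zero    k = trans (cong (k ℕ.+_) (sumℕ-zero r)) (ℕP.+-identityʳ k)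
  where
  sumℕ-zero : ∀ r → sumℕ {r} (λ _ → 0) ≡ 0
  sumℕ-zero zero    = refl
  sumℕ-zero (suc r) = sumℕ-zero r
sumℕ-indicator {suc r} (suc v) k = trans (sumℕ-cong shift) (sumℕ-indicator v k)
  where
  shift : ∀ u → (if ⌊ suc u ≟ suc v ⌋ then k else 0) ≡ (if ⌊ u ≟ v ⌋ then k else 0)
  shift u with u ≟ v
  ... | yes _ = refl
  ... | no _  = refl

below-∪⁅⁆ : ∀ {n} (ρ : Subset n) v w → lookup ρ v ≡ false → below (ρ ∪ ⁅ v ⁆) w ≡ below ρ w ℕ.+ [ v < w ]
below-∪⁅⁆ ρ v w v∉ρ =
  trans (sumℕ-cong split)
        (trans (sumℕ-+ (λ u → if lookup ρ u ∧ (toℕ u <ᵇ toℕ w) then 1 else 0)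
                       (λ u → if ⌊ u ≟ v ⌋ then [ v < w ] else 0))
               (cong (below ρ w ℕ.+_) (sumℕ-indicator v [ v < w ])))
  where
  split : ∀ u → (if lookup (ρ ∪ ⁅ v ⁆) u ∧ (toℕ u <ᵇ toℕ w) then 1 else 0) ≡
                (if lookup ρ u ∧ (toℕ u <ᵇ toℕ w) then 1 else 0) ℕ.+ (if ⌊ u ≟ v ⌋ then [ v < w ] else 0)
  split u rewrite lookup-∪⁅⁆ ρ v u with u ≟ v
  ... | yes refl rewrite v∉ρ = refl
  ... | no _ rewrite ∨-identityʳ (lookup ρ u) = sym (ℕP.+-identityʳ _)

indicator-true : ∀ {b} → T b → (if b then 1 else 0) ≡ 1
indicator-true {true} _ = refl

indicator-false : ∀ {b} → ¬ T b → (if b then 1 else 0) ≡ 0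
indicator-false {true}  ¬t = ⊥-elim (¬t tt)
indicator-false {false} _  = refl

order-cases : ∀ {n} (v w : Fin n) → v ≢ w → ([ v < w ] ≡ 1 × [ w < v ] ≡ 0) ⊎ ([ v < w ] ≡ 0 × [ w < v ] ≡ 1)
order-cases v w v≢w with ℕP.<-cmp (toℕ v) (toℕ w)
... | tri< v<w _ _ = inj₁ (indicator-true (ℕP.<⇒<ᵇ v<w) ,
                           indicator-false (λ t → ℕP.<-asym v<w (ℕP.<ᵇ⇒< _ _ t)))
... | tri≈ _ v≡w _ = ⊥-elim (v≢w (toℕ-injective v≡w))
... | tri> _ _ w<v = inj₂ (indicator-false (λ t → ℕP.<-asym w<v (ℕP.<ᵇ⇒< _ _ t)) ,
                           indicator-true (ℕP.<⇒<ᵇ w<v))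

negPow-+ : ∀ a b → negPow (a ℕ.+ b) ≡ negPow a * negPow b
negPow-+ zero    b = sym (*-identityˡ _)
negPow-+ (suc a) b = trans (cong -_ (negPow-+ a b)) (neg-distribˡ-* (negPow a) (negPow b))

-- Removing w and then v from ρ ∪ {v, w}: the (v, w) term of ∂∂c at ρ.
faces² : ∀ {n} → Chain n → Subset n → Fin n → Fin n → ℤ
faces² c ρ v w = if lookup ρ v then 0ℤ else negPow (below ρ v) * coface c (ρ ∪ ⁅ v ⁆) w

coface-∈ : ∀ {n} (c : Chain n) τ {v} → lookup τ v ≡ true → coface c τ v ≡ 0ℤ
coface-∈ c τ v∈τ rewrite v∈τ = refl

∈-∪⁅⁆ : ∀ {n} (ρ : Subset n) {v} w → lookup ρ v ≡ true → lookup (ρ ∪ ⁅ w ⁆) v ≡ true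
∈-∪⁅⁆ ρ {v} w v∈ρ = trans (lookup-∪⁅⁆ ρ w v) (cong (_∨ ⌊ v ≟ w ⌋) v∈ρ)

faces²-∈ˡ : ∀ {n} (c : Chain n) ρ {v} w → lookup ρ v ≡ true → faces² c ρ v w ≡ 0ℤ
faces²-∈ˡ c ρ w v∈ρ rewrite v∈ρ = refl

faces²-∈ʳ : ∀ {n} (c : Chain n) ρ {v} w → lookup ρ v ≡ true → faces² c ρ w v ≡ 0ℤ
faces²-∈ʳ c ρ {v} w v∈ρ with lookup ρ w
... | true  = refl
... | false = trans (cong (negPow (below ρ w) *_) (coface-∈ c (ρ ∪ ⁅ w ⁆) (∈-∪⁅⁆ ρ w v∈ρ)))
                    (*-zeroʳ (negPow (below ρ w)))

faces²-diagonal : ∀ {n} (c : Chain n) ρ v → faces² c ρ v v ≡ 0ℤ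
faces²-diagonal c ρ v with lookup ρ v
... | true  = refl
... | false = trans (cong (negPow (below ρ v) *_) (coface-∈ c (ρ ∪ ⁅ v ⁆) v∈ρ∪v)) (*-zeroʳ (negPow (below ρ v)))
  where
  v∈ρ∪v : lookup (ρ ∪ ⁅ v ⁆) v ≡ true
  v∈ρ∪v = trans (lookup-∪⁅⁆ ρ v v) (trans (cong (lookup ρ v ∨_) (⌊≟⌋-refl v)) (∨-zeroʳ _))

faces²-value : ∀ {n} (c : Chain n) ρ {v w} → lookup ρ v ≡ false → lookup ρ w ≡ false → w ≢ v →
               faces² c ρ v w ≡ negPow (below ρ v) * (negPow (below ρ w) * negPow [ v < w ] * c ((ρ ∪ ⁅ v ⁆) ∪ ⁅ w ⁆))
faces²-value c ρ {v} {w} v∉ρ w∉ρ w≢v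
  rewrite v∉ρ | ∉-∪⁅⁆ ρ w∉ρ w≢v | below-∪⁅⁆ ρ v w v∉ρ | negPow-+ (below ρ w) [ v < w ] = refl

faces²-antisymmetric : ∀ {n} (c : Chain n) ρ v w → faces² c ρ v w ≡ - faces² c ρ w v
faces²-antisymmetric c ρ v w with lookup ρ v Bool.≟ true | lookup ρ w Bool.≟ true | v ≟ w
... | yes v∈ρ | _       | _        = trans (faces²-∈ˡ c ρ w v∈ρ) (sym (cong -_ (faces²-∈ʳ c ρ w v∈ρ)))
... | no _    | yes w∈ρ | _        = trans (faces²-∈ʳ c ρ v w∈ρ) (sym (cong -_ (faces²-∈ˡ c ρ v w∈ρ)))
... | no _    | no _    | yes refl = trans (faces²-diagonal c ρ v) (sym (cong -_ (faces²-diagonal c ρ v)))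
... | no v∉ρ  | no w∉ρ  | no v≢w   = begin
  faces² c ρ v w                                   ≡⟨ faces²-value c ρ (¬-true v∉ρ) (¬-true w∉ρ) (λ w≡v → v≢w (sym w≡v)) ⟩
  εv * (εw * negPow [ v < w ] * c ((ρ ∪ ⁅ v ⁆) ∪ ⁅ w ⁆)) ≡⟨ cong (λ σ → εv * (εw * negPow [ v < w ] * c σ)) (∪⁅⁆-comm ρ v w) ⟩
  εv * (εw * negPow [ v < w ] * c σ)               ≡⟨ opposite-signs (order-cases v w v≢w) ⟩
  - (εw * (εv * negPow [ w < v ] * c σ))           ≡⟨ cong -_ (sym (faces²-value c ρ (¬-true w∉ρ) (¬-true v∉ρ) v≢w)) ⟩
  - faces² c ρ w v ∎
  where
  open ≡-Reasoning
  εv = negPow (below ρ v)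
  εw = negPow (below ρ w)
  σ = (ρ ∪ ⁅ w ⁆) ∪ ⁅ v ⁆
  ¬-true : ∀ {b} → b ≢ true → b ≡ false
  ¬-true {true}  b≢true = ⊥-elim (b≢true refl)
  ¬-true {false} _      = refl
  opposite-signs : ([ v < w ] ≡ 1 × [ w < v ] ≡ 0) ⊎ ([ v < w ] ≡ 0 × [ w < v ] ≡ 1) →
                   εv * (εw * negPow [ v < w ] * c σ) ≡ - (εw * (εv * negPow [ w < v ] * c σ))
  opposite-signs (inj₁ (v<w , w≮v)) rewrite v<w | w≮v = swap₁ εv εw (c σ)
    where swap₁ : ∀ a b x → a * (b * - 1ℤ * x) ≡ - (b * (a * 1ℤ * x))
          swap₁ = solve-∀
  opposite-signs (inj₂ (v≮w , w<v)) rewrite v≮w | w<v = swap₂ εv εw (c σ)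
    where swap₂ : ∀ a b x → a * (b * 1ℤ * x) ≡ - (b * (a * - 1ℤ * x))
          swap₂ = solve-∀

sumℤ-antisymmetric : ∀ {n} (G : Fin n → Fin n → ℤ) → (∀ v w → G v w ≡ - G w v) →
                     sumℤ (λ v → sumℤ (G v)) ≡ 0ℤ
sumℤ-antisymmetric G antisym = self-negative _ (begin
  sumℤ (λ v → sumℤ (G v))                  ≡⟨ sumℤ-swap G ⟩
  sumℤ (λ w → sumℤ (λ v → G v w))          ≡⟨ sumℤ-cong (λ w → trans (sumℤ-cong (λ v → antisym v w)) (sumℤ-neg (G w))) ⟩
  sumℤ (λ w → - sumℤ (G w))                ≡⟨ sumℤ-neg (λ w → sumℤ (G w)) ⟩
  - sumℤ (λ v → sumℤ (G v))                ∎)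
  where
  open ≡-Reasoning
  self-negative : ∀ x → x ≡ - x → x ≡ 0ℤ
  self-negative (+ zero)  _  = refl
  self-negative +[1+ n ]  ()
  self-negative -[1+ n ]  ()

bd∘bd : ∀ {n} q (c : Chain n) → bd q (bd (suc q) c) ≈ 0c
bd∘bd zero    c ρ = refl
bd∘bd (suc q) c ρ =
  trans (sumℤ-cong (λ v → sum-inside (lookup ρ v) (negPow (below ρ v)) (coface c (ρ ∪ ⁅ v ⁆))))
        (sumℤ-antisymmetric (faces² c ρ) (faces²-antisymmetric c ρ))
  where
  sum-inside : ∀ {r} (b : Bool) (a : ℤ) (g : Fin r → ℤ) →
               (if b then 0ℤ else a * sumℤ g) ≡ sumℤ (λ w → if b then 0ℤ else a * g w)
  sum-inside {r} true  a g = sym (sumℤ-zero {r} (λ _ → refl))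
  sum-inside false a g = sym (sumℤ-*ˡ a g)

sumℤ-nonzero : ∀ {r} (f : Fin r → ℤ) → sumℤ f ≢ 0ℤ → Σ (Fin r) λ i → f i ≢ 0ℤ
sumℤ-nonzero {zero}  f sum≢0 = ⊥-elim (sum≢0 refl)
sumℤ-nonzero {suc r} f sum≢0 with nonzero-sum (f zero) _ sum≢0
... | inj₁ f0≢0   = zero , f0≢0
... | inj₂ rest≢0 with sumℤ-nonzero (λ i → f (suc i)) rest≢0
...   | i , fi≢0  = suc i , fi≢0

-- ∂ maps (q+1)-chains of K to q-chains of K: a face of a simplex of K is a
-- simplex of K, with one vertex less.
bd-chain : ∀ {n} (K : SimplicialComplex n) q (c : Chain n) → IsChain K (suc q) c → IsChain K q (bd (suc q) c)
bd-chain K q c Kc τ ∂cτ≢0 with sumℤ-nonzero (coface c τ) ∂cτ≢0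
... | v , term≢0 = face (lookup τ v) refl term≢0
  where
  face : ∀ b → lookup τ v ≡ b → (if b then 0ℤ else negPow (below τ v) * c (τ ∪ ⁅ v ⁆)) ≢ 0ℤ → IsQSimplex K q τ
  face true  _   0≢0     = ⊥-elim (0≢0 refl)
  face false v∉τ term≢0′ =
    downClosed K (τ ∪ ⁅ v ⁆) τ coface-simplex (p⊆p∪q ⁅ v ⁆) (nonempty-of-size τ q size) , size
    where
    cτv≢0 : c (τ ∪ ⁅ v ⁆) ≢ 0ℤ
    cτv≢0 cτv≡0 = term≢0′ (trans (cong (negPow (below τ v) *_) cτv≡0) (*-zeroʳ (negPow (below τ v))))
    coface-simplex = proj₁ (Kc (τ ∪ ⁅ v ⁆) cτv≢0)
    size : ∣ τ ∣ₛ ≡ suc q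
    size = ℕP.suc-injective (trans (sym (∣∪⁅⁆∣ τ v v∉τ)) (proj₂ (Kc (τ ∪ ⁅ v ⁆) cτv≢0)))

bd-hom-chains : ∀ {n} (K : SimplicialComplex n) q → IsHom (IsChain K (suc q)) (IsChain K q) (bd (suc q))
bd-hom-chains K q = record
  { maps = bd-chain K q ; resp = λ _ _ _ _ → bd-resp (suc q) ; additive = λ c c' _ _ → bd-+ (suc q) c c' }

_·v_ : ∀ {m r} → Matrix m r → (Fin r → ℤ) → Fin m → ℤ
(M ·v a) i = sumℤ (λ j → M i j * a j)

infixr 20 _·v_

·v-cong : ∀ {m r} {M N : Matrix m r} {a a' : Fin r → ℤ} → M ≈M N → (∀ j → a j ≡ a' j) → ∀ i → (M ·v a) i ≡ (N ·v a') i
·v-cong M≈N a≡a' i = sumℤ-cong (λ j → cong₂ _*_ (M≈N i j) (a≡a' j))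

⊗-·v : ∀ {m k r} (A : Matrix m k) (B : Matrix k r) (a : Fin r → ℤ) i → ((A ⊗ B) ·v a) i ≡ (A ·v B ·v a) i
⊗-·v A B a i = begin
  sumℤ (λ j → sumℤ (λ l → A i l * B l j) * a j)     ≡⟨ sumℤ-cong (λ j → sym (sumℤ-*ʳ (a j) (λ l → A i l * B l j))) ⟩
  sumℤ (λ j → sumℤ (λ l → A i l * B l j * a j))     ≡⟨ sumℤ-swap (λ j l → A i l * B l j * a j) ⟩
  sumℤ (λ l → sumℤ (λ j → A i l * B l j * a j))
    ≡⟨ sumℤ-cong (λ l → trans (sumℤ-cong (λ j → *-assoc (A i l) (B l j) (a j))) (sumℤ-*ˡ (A i l) (λ j → B l j * a j))) ⟩
  sumℤ (λ l → A i l * sumℤ (λ j → B l j * a j))     ∎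
  where open ≡-Reasoning

lc-·v : ∀ {n m r} (M : Matrix m r) (a : Fin r → ℤ) (b : Fin m → Chain n) →
        lc (M ·v a) b ≈ lc a (λ j → lc (λ i → M i j) b)
lc-·v M a b σ = begin
  sumℤ (λ i → sumℤ (λ j → M i j * a j) * b i σ)     ≡⟨ sumℤ-cong (λ i → sym (sumℤ-*ʳ (b i σ) (λ j → M i j * a j))) ⟩
  sumℤ (λ i → sumℤ (λ j → M i j * a j * b i σ))     ≡⟨ sumℤ-swap (λ i j → M i j * a j * b i σ) ⟩
  sumℤ (λ j → sumℤ (λ i → M i j * a j * b i σ))
    ≡⟨ sumℤ-cong (λ j → trans (sumℤ-cong (λ i → reorder (M i j) (a j) (b i σ))) (sumℤ-*ˡ (a j) (λ i → M i j * b i σ))) ⟩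
  sumℤ (λ j → a j * sumℤ (λ i → M i j * b i σ))     ∎
  where
  open ≡-Reasoning
  reorder : ∀ x y z → x * y * z ≡ y * (x * z)
  reorder = solve-∀

record NonzeroPrefix {r} (f : Fin r → ℤ) : Set where
  field
    s        : ℕ
    s≤r      : s ℕ.≤ r
    nonzero  : ∀ (k : Fin s) → f (inject≤ k s≤r) ≢ 0ℤ
    zero-from : ∀ i → s ℕ.≤ toℕ i → f i ≡ 0ℤ

nonzero-prefix : ∀ {r} (f : Fin r → ℤ) →
                 (∀ i i' → toℕ i' ≡ suc (toℕ i) → f i ≡ 0ℤ → f i' ≡ 0ℤ) → NonzeroPrefix f
nonzero-prefix {zero}  f propagate = record { s = 0 ; s≤r = z≤n ; nonzero = λ () ; zero-from = λ () }
nonzero-prefix {suc r} f propagate with f zero ℤ.≟ 0ℤ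
... | yes f0≡0 = record { s = 0 ; s≤r = z≤n ; nonzero = λ () ; zero-from = λ i _ → all-zero (toℕ i) i refl }
  where
  all-zero : ∀ t (i : Fin (suc r)) → toℕ i ≡ t → f i ≡ 0ℤ
  all-zero zero    zero    _   = f0≡0
  all-zero zero    (suc i) ()
  all-zero (suc t) zero    ()
  all-zero (suc t) (suc i) i≡t = propagate (inject₁ i) (suc i) (cong suc (sym (toℕ-inject₁ i)))
    (all-zero t (inject₁ i) (trans (toℕ-inject₁ i) (ℕP.suc-injective i≡t)))
... | no f0≢0 = record
  { s = suc s ; s≤r = s≤s s≤r
  ; nonzero = λ { zero → f0≢0 ; (suc k) → nonzero k }
  ; zero-from = λ { zero () ; (suc i) (s≤s s≤i) → zero-from i s≤i } }
  where open NonzeroPrefix (nonzero-prefix (λ i → f (suc i)) (λ i i' i'≡1+i → propagate (suc i) (suc i') (cong suc i'≡1+i)))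

sumℤ-prefix : ∀ {r} s (s≤r : s ℕ.≤ r) (f : Fin r → ℤ) → (∀ i → s ℕ.≤ toℕ i → f i ≡ 0ℤ) →
              sumℤ f ≡ sumℤ {s} (λ k → f (inject≤ k s≤r))
sumℤ-prefix zero    _         f vanish = sumℤ-zero (λ i → vanish i z≤n)
sumℤ-prefix (suc s) (s≤s s≤r) f vanish =
  cong (_+_ (f zero)) (sumℤ-prefix s s≤r (λ i → f (suc i)) (λ i s≤i → vanish (suc i) (s≤s s≤i)))

-- Let Λ be the matrix of L and D = U Λ V its Smith normal form.  The
-- columns of U⁻¹ D at the nonzero diagonal entries of D give a basis of the
-- image: they lie in it since Λ V = U⁻¹ D, they span it since
-- Λ = (U⁻¹ D) V⁻¹, and they are independent since U (U⁻¹ D) = D is diagonal.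
module ImageBasis {n} {P : Chain n → Set} (SP : Submodule P) {r} (e : Fin r → Chain n)
                  (basis : IsBasis P e) {L : Chain n → Chain n} (HL : IsHom P P L) where

  open IsBasis basis
  open Linear SP SP HL using (h-lc)

  Image : Chain n → Set
  Image x = ∃ λ c → P c × (x ≈ L c)

  coordinates : ∀ c → P c → Fin r → ℤ
  coordinates c Pc = proj₁ (spanning c Pc)

  Λ : Matrix r r
  Λ i j = coordinates (L (e j)) (IsHom.maps HL (e j) (inP j)) i

  L-coordinates : ∀ a → L (lc a e) ≈ lc (Λ ·v a) e
  L-coordinates a σ = trans (h-lc a e inP σ)
    (trans (sumℤ-cong (λ j → cong (a j *_) (proj₂ (spanning _ (IsHom.maps HL (e j) (inP j))) σ)))
           (sym (lc-·v Λ a e σ)))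

  snf = proj₂ (smith-normal-form r r Λ)
  open IsSNFOf snf using (diag; divChain) renaming (P to U; Q to V)
  D = proj₁ (smith-normal-form r r Λ)
  U⁻¹ = proj₁ (IsSNFOf.invP snf)
  V⁻¹ = proj₁ (IsSNFOf.invQ snf)

  ΛV≈U⁻¹D : (Λ ⊗ V) ≈M (U⁻¹ ⊗ D)
  ΛV≈U⁻¹D = begin
    Λ ⊗ V                           ≈⟨ ⊗-congʳ V (IsSNFOf-recover snf) ⟩
    ((U⁻¹ ⊗ D) ⊗ V⁻¹) ⊗ V           ≈⟨ ⊗-assoc (U⁻¹ ⊗ D) V⁻¹ V ⟩
    (U⁻¹ ⊗ D) ⊗ (V⁻¹ ⊗ V)           ≈⟨ ⊗-congˡ (U⁻¹ ⊗ D) (proj₂ (proj₂ (IsSNFOf.invQ snf))) ⟩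
    (U⁻¹ ⊗ D) ⊗ Id                  ≈⟨ ⊗-Id (U⁻¹ ⊗ D) ⟩
    U⁻¹ ⊗ D                         ∎
    where open ≈M-Reasoning

  UU⁻¹D≈D : (U ⊗ (U⁻¹ ⊗ D)) ≈M D
  UU⁻¹D≈D = ≈M.trans (≈M.sym (⊗-assoc U U⁻¹ D))
                     (≈M.trans (⊗-congʳ D (proj₁ (proj₂ (IsSNFOf.invP snf)))) (Id-⊗ D))

  prefix : NonzeroPrefix (λ i → D i i)
  prefix = nonzero-prefix (λ i → D i i) λ i i' i'≡1+i Dii≡0 →
    ∣i∣≡0⇒i≡0 (ℕD.0∣⇒≡0 (subst (λ y → ∣ y ∣ ℕD.∣ ∣ D i' i' ∣) Dii≡0 (divChain i i' i i' refl refl i'≡1+i)))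
  open NonzeroPrefix prefix

  rank : ℕ
  rank = s

  ι : Fin s → Fin r
  ι k = inject≤ k s≤r

  columns : Matrix r s
  columns i k = (U⁻¹ ⊗ D) i (ι k)

  β : Fin s → Chain n
  β k = lc (λ i → columns i k) e

  column-zero : ∀ i j → s ℕ.≤ toℕ j → (U⁻¹ ⊗ D) i j ≡ 0ℤ
  column-zero i j s≤j = sumℤ-zero (λ l → trans (cong (U⁻¹ i l *_) (D-zero l)) (*-zeroʳ (U⁻¹ i l)))
    where
    D-zero : ∀ l → D l j ≡ 0ℤ
    D-zero l with l ≟ j
    ... | yes refl = zero-from l s≤j
    ... | no l≢j   = diag l j (λ l≡j → l≢j (toℕ-injective l≡j))

  β-image : ∀ k → Image (β k)
  β-image k = lc (λ i → V i (ι k)) e , P-lc SP (λ i → V i (ι k)) e inP ,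
    ≈-sym (≈-trans (L-coordinates (λ i → V i (ι k))) (lc-cong e (λ i → ΛV≈U⁻¹D i (ι k))))

  β-spanning : ∀ x → Image x → ∃ λ γ → x ≈ lc γ β
  β-spanning x (c , Pc , x≈Lc) = γ , ≈-trans x≈Lc (≈-trans L-in-e (lc-·v columns γ e))
    where
    a = coordinates c Pc
    w = V⁻¹ ·v a
    γ : Fin s → ℤ
    γ k = w (ι k)
    Λa≡ : ∀ i → (Λ ·v a) i ≡ (columns ·v γ) i
    Λa≡ i = trans (·v-cong (IsSNFOf-recover snf) (λ _ → refl) i)
      (trans (⊗-·v (U⁻¹ ⊗ D) V⁻¹ a i)
             (sumℤ-prefix s s≤r _ (λ j s≤j → trans (cong (_* w j) (column-zero i j s≤j)) refl)))
    L-in-e : L c ≈ lc (columns ·v γ) e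
    L-in-e = ≈-trans (IsHom.resp HL c (lc a e) Pc (P-lc SP a e inP) (proj₂ (spanning c Pc)))
                     (≈-trans (L-coordinates a) (lc-cong e Λa≡))

  β-independent : ∀ (γ : Fin s → ℤ) → lc γ β ≈ 0c → ∀ k → γ k ≡ 0ℤ
  β-independent γ lcγβ≈0 k =
    [ (λ Dkk≡0 → ⊥-elim (nonzero k Dkk≡0)) , (λ γk≡0 → γk≡0) ] (i*j≡0⇒i≡0∨j≡0 (D (ι k) (ι k)) Dγ≡0)
    where
    columns·γ≡0 : ∀ i → (columns ·v γ) i ≡ 0ℤ
    columns·γ≡0 = independent (columns ·v γ) (≈-trans (lc-·v columns γ e) lcγβ≈0)
    diagonal-term : ∀ k' → D (ι k) (ι k') * γ k' ≡ Id k k' * (D (ι k) (ι k) * γ k')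
    diagonal-term k' with k ≟ k'
    ... | yes refl = sym (*-identityˡ _)
    ... | no k≢k'  = cong (_* γ k') (diag (ι k) (ι k') λ ιk≡ιk' → k≢k'
            (toℕ-injective (trans (sym (toℕ-inject≤ k s≤r)) (trans ιk≡ιk' (toℕ-inject≤ k' s≤r)))))
    Dγ≡0 : D (ι k) (ι k) * γ k ≡ 0ℤ
    Dγ≡0 = begin
      D (ι k) (ι k) * γ k                           ≡⟨ sym (sum-Idˡ k (λ k' → D (ι k) (ι k) * γ k')) ⟩
      sumℤ (λ k' → Id k k' * (D (ι k) (ι k) * γ k')) ≡⟨ sumℤ-cong (λ k' → sym (diagonal-term k')) ⟩
      sumℤ (λ k' → D (ι k) (ι k') * γ k')           ≡⟨ sym (·v-cong (λ i k' → UU⁻¹D≈D i (ι k')) (λ _ → refl) (ι k)) ⟩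
      ((U ⊗ columns) ·v γ) (ι k)                    ≡⟨ ⊗-·v U columns γ (ι k) ⟩
      (U ·v columns ·v γ) (ι k)                     ≡⟨ sumℤ-zero (λ i → trans (cong (U (ι k) i *_) (columns·γ≡0 i)) (*-zeroʳ (U (ι k) i))) ⟩
      0ℤ                                            ∎
      where open ≡-Reasoning

  image-basis : IsBasis Image β
  image-basis = record { inP = β-image ; independent = β-independent ; spanning = β-spanning }

module Contraction {n} (K : SimplicialComplex n) (φ : ℕ → Chain n → Chain n)
                   (φ-hom : ∀ q → IsHom (IsChain K q) (IsChain K (suc q)) (φ q))
                   (φφ  : ∀ q c → IsChain K q c → φ (suc q) (φ q c) ≈ 0c)
                   (φ∂φ : ∀ q c → IsChain K q c → φ q (bd (suc q) (φ q c)) ≈ φ q c) where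

  module Φ q = Linear (chains K q) (chains K (suc q)) (φ-hom q)

  φ∂-hom : ∀ q → IsHom (IsChain K q) (IsChain K q) (λ c → prev φ q (bd q c))
  φ∂-hom zero    = hom-0 (chains K zero)
  φ∂-hom (suc q) = hom-∘ (chains K (suc q)) (chains K q) (bd-hom-chains K q) (φ-hom q)

  ∂φ-hom : ∀ q → IsHom (IsChain K q) (IsChain K q) (λ c → bd (suc q) (φ q c))
  ∂φ-hom q = hom-∘ (chains K q) (chains K (suc q)) (φ-hom q) (bd-hom-chains K q)

  π-hom : ∀ q → IsHom (IsChain K q) (IsChain K q) (π φ q)
  π-hom q = hom-- (chains K q) (hom-- (chains K q) hom-id (φ∂-hom q)) (∂φ-hom q)

  module Π q = Linear (chains K q) (chains K q) (π-hom q)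

  π-chain : ∀ q c → IsChain K q c → IsChain K q (π φ q c)
  π-chain q = IsHom.maps (π-hom q)

  M-chain : ∀ q x → InM K φ q x → IsChain K q x
  M-chain q x (c , Kc , x≈πc) = P-≈ (chains K q) (≈-sym x≈πc) (π-chain q c Kc)

  M-submodule : ∀ q → Submodule (InM K φ q)
  M-submodule q = record
    { P-0 = 0c , P-0 (chains K q) , ≈-sym (Π.h-0 q)
    ; P-+ = λ { (c , Kc , x≈πc) (c' , Kc' , x'≈πc') → c +c c' , P-+ (chains K q) Kc Kc' ,
                ≈-trans (λ σ → cong₂ _+_ (x≈πc σ) (x'≈πc' σ)) (≈-sym (IsHom.additive (π-hom q) c c' Kc Kc')) }
    ; P-· = λ { k (c , Kc , x≈πc) → k ·c c , P-· (chains K q) k Kc ,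
                ≈-trans (λ σ → cong (k *_) (x≈πc σ)) (≈-sym (Π.h-· q k Kc)) }
    ; P-≈ = λ { x≈x' (c , Kc , x≈πc) → c , Kc , ≈-trans (≈-sym x≈x') x≈πc } }

  φ∂-bd : ∀ q c → IsChain K (suc q) c → prev φ q (bd q (bd (suc q) c)) ≈ 0c
  φ∂-bd zero    c Kc σ = refl
  φ∂-bd (suc q) c Kc = Φ.h-resp-0 q (bd-chain K q _ (bd-chain K (suc q) c Kc)) (bd∘bd (suc q) c)

  φ∂-cycle : ∀ q c → IsChain K q c → bd q c ≈ 0c → prev φ q (bd q c) ≈ 0c
  φ∂-cycle zero    c Kc ∂c≈0 = λ _ → refl
  φ∂-cycle (suc q) c Kc ∂c≈0 = Φ.h-resp-0 q (bd-chain K q c Kc) ∂c≈0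

  -- π is a chain map: both sides equal ∂c - ∂φ∂c.
  π-bd : ∀ q c → IsChain K (suc q) c → π φ q (bd (suc q) c) ≈ bd (suc q) (π φ (suc q) c)
  π-bd q c Kc σ = begin
    bd (suc q) c σ - prev φ q (bd q (bd (suc q) c)) σ - X σ
      ≡⟨ cong (λ y → bd (suc q) c σ - y - X σ) (φ∂-bd q c Kc σ) ⟩
    bd (suc q) c σ - 0ℤ - X σ
      ≡⟨ swap-last (bd (suc q) c σ) (X σ) ⟩
    bd (suc q) c σ - X σ - 0ℤ
      ≡⟨ cong (_- 0ℤ) (sym (BdLinear.h-- (suc q) {c} {φ q (bd (suc q) c)} _ _ σ)) ⟩
    bd (suc q) (c -c φ q (bd (suc q) c)) σ - 0ℤ
      ≡⟨ cong (_-_ (bd (suc q) (c -c φ q (bd (suc q) c)) σ)) (sym (bd∘bd (suc q) (φ (suc q) c) σ)) ⟩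
    bd (suc q) (c -c φ q (bd (suc q) c)) σ - bd (suc q) (bd (suc (suc q)) (φ (suc q) c)) σ
      ≡⟨ sym (BdLinear.h-- (suc q) {c -c φ q (bd (suc q) c)} {bd (suc (suc q)) (φ (suc q) c)} _ _ σ) ⟩
    bd (suc q) (π φ (suc q) c) σ ∎
    where
    open ≡-Reasoning
    X = bd (suc q) (φ q (bd (suc q) c))
    swap-last : ∀ a b → a - 0ℤ - b ≡ a - b - 0ℤ
    swap-last = solve-∀

  φφ∂ : ∀ q c → IsChain K q c → φ q (prev φ q (bd q c)) ≈ 0c
  φφ∂ zero    c Kc = Φ.h-0 zero
  φφ∂ (suc q) c Kc = φφ q (bd (suc q) c) (bd-chain K q c Kc)

  -- φπ = φ - φφ∂ - φ∂φ = φ - 0 - φ = 0.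
  φπ : ∀ q c → IsChain K q c → φ q (π φ q c) ≈ 0c
  φπ q c Kc σ = begin
    φ q (π φ q c) σ
      ≡⟨ Φ.h-- q (P-- (chains K q) Kc (IsHom.maps (φ∂-hom q) c Kc)) (IsHom.maps (∂φ-hom q) c Kc) σ ⟩
    φ q (c -c prev φ q (bd q c)) σ - φ q (bd (suc q) (φ q c)) σ
      ≡⟨ cong₂ _-_ (Φ.h-- q Kc (IsHom.maps (φ∂-hom q) c Kc) σ) (φ∂φ q c Kc σ) ⟩
    φ q c σ - φ q (prev φ q (bd q c)) σ - φ q c σ
      ≡⟨ cong (λ y → φ q c σ - y - φ q c σ) (φφ∂ q c Kc σ) ⟩
    φ q c σ - 0ℤ - φ q c σ
      ≡⟨ cancel (φ q c σ) ⟩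
    0ℤ ∎
    where
    open ≡-Reasoning
    cancel : ∀ a → a - 0ℤ - a ≡ 0ℤ
    cancel = solve-∀

  -- φ∂ vanishes on the image of π, as φπ = 0 and π∂ = ∂π.
  φ∂π : ∀ q c → IsChain K q c → prev φ q (bd q (π φ q c)) ≈ 0c
  φ∂π zero    c Kc = λ _ → refl
  φ∂π (suc q) c Kc = ≈-trans
    (IsHom.resp (φ-hom q) _ _ (bd-chain K q _ (π-chain (suc q) c Kc)) (π-chain q _ (bd-chain K q c Kc))
                (≈-sym (π-bd q c Kc)))
    (φπ q (bd (suc q) c) (bd-chain K q c Kc))

  -- π is idempotent: both correction terms vanish on π c.
  ππ : ∀ q c → IsChain K q c → π φ q (π φ q c) ≈ π φ q c
  ππ q c Kc σ = trans (cong₂ (λ y z → π φ q c σ - y - z) (φ∂π q c Kc σ) ∂φπ) (drop-zeros (π φ q c σ))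
    where
    ∂φπ : bd (suc q) (φ q (π φ q c)) σ ≡ 0ℤ
    ∂φπ = trans (bd-resp (suc q) (φπ q c Kc) σ) (BdLinear.h-0 (suc q) σ)
    drop-zeros : ∀ a → a - 0ℤ - 0ℤ ≡ a
    drop-zeros = solve-∀

  π-on-M : ∀ q x → InM K φ q x → π φ q x ≈ x
  π-on-M q x (c , Kc , x≈πc) =
    ≈-trans (IsHom.resp (π-hom q) x (π φ q c) (M-chain q x (c , Kc , x≈πc)) (π-chain q c Kc) x≈πc)
            (≈-trans (ππ q c Kc) (≈-sym x≈πc))

  -- 𝓜 is a subcomplex: ∂(π c) = π(∂c) ∈ 𝓜.
  M-diff-hom : ∀ q → IsHom (InM K φ (suc q)) (InM K φ q) (bd (suc q))
  M-diff-hom q = record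
    { maps     = λ { x (c , Kc , x≈πc) → bd (suc q) c , bd-chain K q c Kc ,
                     ≈-trans (bd-resp (suc q) x≈πc) (≈-sym (π-bd q c Kc)) }
    ; resp     = λ _ _ _ _ → bd-resp (suc q)
    ; additive = λ c c' _ _ → bd-+ (suc q) c c' }

  M-is-chain-complex : IsChainCx (𝓜 K φ)
  M-is-chain-complex = record { diffHom = M-diff-hom ; dd = λ q c _ → bd∘bd (suc q) c }

  π-contraction : IsChainContraction (𝒞 K) (𝓜 K φ) (π φ) (λ q x → x) φ
  π-contraction = record
    { fHom = λ q → record { maps = λ c Kc → c , Kc , ≈-refl
                          ; resp = IsHom.resp (π-hom q) ; additive = IsHom.additive (π-hom q) }
    ; gHom = λ q → record { maps = M-chain q ; resp = λ _ _ _ _ x≈x' → x≈x' ; additive = λ _ _ _ _ σ → refl }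
    ; φHom = φ-hom
    ; fd   = π-bd
    ; dg   = λ q x _ σ → refl
    ; fg   = π-on-M
    ; htpy = λ q c _ σ → homotopy (c σ) (prev φ q (bd q c) σ) (bd (suc q) (φ q c) σ) }
    where
    homotopy : ∀ c a b → a + b ≡ c - (c - a - b)
    homotopy = solve-∀

scale-out : ∀ {n m r} {δ} (A : Matrix m r) → δ ∣M A → (a : Fin r → ℤ) (b : Fin m → Chain n) →
            ∃ λ t → lc (A ·v a) b ≈ (δ ·c lc t b)
scale-out {m = m} {r} {δ} A δ∣A a b = quotients ·v a , ≈-trans (lc-cong b factor) (lc-scale δ (quotients ·v a) b)
  where
  quotients : Matrix m r
  quotients i j = _∣_.quotient (δ∣A i j)
  factor : ∀ i → (A ·v a) i ≡ δ * (quotients ·v a) i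
  factor i = trans (sumℤ-cong λ j → trans (cong (_* a j) (trans (_∣_.equality (δ∣A i j)) (*-comm _ δ)))
                                           (*-assoc δ (quotients i j) (a j)))
                   (sumℤ-*ˡ δ (λ j → quotients i j * a j))

-- Then the image of d is
-- divisible by one δ which is 0 or greater than 1: the first entry of the Smith
-- normal form of the matrix of d, which divides all entries of that matrix.
common-divisor : ∀ {n} {P Q : Chain n → Set} → Submodule P → Submodule Q →
                 ∀ {d} → IsHom P Q d → SNFCondition P Q d →
                 ∀ {r} (b : Fin r → Chain n) → IsBasis P b → ∀ {m} (b' : Fin m → Chain n) → IsBasis Q b' →
                 Σ ℤ λ δ → (δ ≡ 0ℤ ⊎ 1ℤ ℤ.< δ) × (∀ x → P x → ∃ λ z → Q z × (d x ≈ (δ ·c z)))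
common-divisor SP SQ D _ {zero} b basis b' _ = 0ℤ , inj₁ refl , λ x Px → 0c , P-0 SQ ,
  ≈-trans (IsHom.resp D x (lc (proj₁ (IsBasis.spanning basis x Px)) b) Px (P-lc SP (proj₁ (IsBasis.spanning basis x Px)) b (λ ())) (proj₂ (IsBasis.spanning basis x Px)))
          (Linear.h-0 SP SQ D)
common-divisor SP SQ D _ {suc r} b _ {zero} b' basis' = 0ℤ , inj₁ refl , λ x Px → 0c , P-0 SQ ,
  proj₂ (IsBasis.spanning basis' _ (IsHom.maps D x Px))
common-divisor {P = P} {Q} SP SQ {d} D snf-condition {suc r} b basis {suc m} b' basis' = δ , δ-cases , divisible
  where
  A : Matrix (suc m) (suc r)
  A i j = proj₁ (IsBasis.spanning basis' _ (IsHom.maps D (b j) (IsBasis.inP basis j))) i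
  A-matrix : IsMatrixOf d b b' A
  A-matrix j = proj₂ (IsBasis.spanning basis' _ (IsHom.maps D (b j) (IsBasis.inP basis j)))
  snf = proj₂ (smith-normal-form (suc m) (suc r) A)
  δ = proj₁ (smith-normal-form (suc m) (suc r) A) zero zero
  δ-cases : δ ≡ 0ℤ ⊎ 1ℤ ℤ.< δ
  δ-cases with δ ℤ.≟ 0ℤ
  ... | yes δ≡0 = inj₁ δ≡0
  ... | no δ≢0  = inj₂ (snf-condition b b' basis basis' A A-matrix _ snf zero zero δ≢0)
  divisible : ∀ x → P x → ∃ λ z → Q z × (d x ≈ (δ ·c z))
  divisible x Px = lc t b' , P-lc SQ t b' (IsBasis.inP basis') ,
    ≈-trans dx≈lc (proj₂ (scale-out A (corner-divides snf) a b'))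
    where
    a = proj₁ (IsBasis.spanning basis x Px)
    t = proj₁ (scale-out A (corner-divides snf) a b')
    dx≈lc : d x ≈ lc (A ·v a) b'
    dx≈lc σ = begin
      d x σ                                  ≡⟨ IsHom.resp D _ _ Px (P-lc SP a b (IsBasis.inP basis)) (proj₂ (IsBasis.spanning basis x Px)) σ ⟩
      d (lc a b) σ                           ≡⟨ Linear.h-lc SP SQ D a b (IsBasis.inP basis) σ ⟩
      lc a (λ j → d (b j)) σ                 ≡⟨ sumℤ-cong (λ j → cong (a j *_) (A-matrix j σ)) ⟩
      lc a (λ j → lc (λ i → A i j) b') σ     ≡⟨ sym (lc-·v A a b' σ) ⟩
      lc (A ·v a) b' σ                       ∎
      where open ≡-Reasoning

powers-grow : ∀ {δ} → 1ℤ ℤ.< δ → ∀ N → N ℕ.< ∣ δ ^ N ∣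
powers-grow         1<δ zero    = s≤s z≤n
powers-grow {δ} 1<δ@(+<+ 1<∣δ∣) (suc N) = begin-strict
  1 ℕ.+ N                  <⟨ ℕP.+-mono-≤-< (ℕP.≤-trans (s≤s z≤n) N<p) N<p ⟩
  p ℕ.+ p                  ≡⟨ cong (p ℕ.+_) (sym (ℕP.+-identityʳ p)) ⟩
  2 ℕ.* p                  ≤⟨ ℕP.*-monoˡ-≤ p 1<∣δ∣ ⟩
  ∣ δ ∣ ℕ.* p              ≡⟨ sym (abs-* δ (δ ^ N)) ⟩
  ∣ δ ^ suc N ∣            ∎
  where
  open ℕP.≤-Reasoning
  p = ∣ δ ^ N ∣
  N<p = powers-grow 1<δ N

divisible-by-all-powers : ∀ {δ} → 1ℤ ℤ.< δ → ∀ x → (∀ N → δ ^ N ∣ x) → x ≡ 0ℤ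
divisible-by-all-powers {δ} 1<δ x δ^N∣x with ∣ x ∣ ℕ.≟ 0
... | yes ∣x∣≡0 = ∣i∣≡0⇒i≡0 ∣x∣≡0
... | no ∣x∣≢0 = ⊥-elim (ℕP.<⇒≱ (powers-grow 1<δ ∣ x ∣)
                   (ℕD.∣⇒≤ {{ℕ.≢-nonZero ∣x∣≢0}} (∣⇒∣ᵤ (δ^N∣x ∣ x ∣))))


1<⇒≢0 : ∀ {δ} → 1ℤ ℤ.< δ → δ ≢ 0ℤ
1<⇒≢0 (+<+ ()) refl

module AMModelHomology {n} (K : SimplicialComplex n) (C : ℕ → Σ ℕ λ r → Fin r → Chain n)
                       (φ : ℕ → Chain n → Chain n) (am : IsAMModel K C φ) where
  open IsAMModel am
  open Contraction K φ φHom φφ φ∂φ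

  module M-image q = ImageBasis (chains K q) (proj₂ (C q)) (basisC q) (π-hom q)

  M-basis : ∀ q → Σ ℕ λ s → Σ (Fin s → Chain n) λ β → IsBasis (InM K φ q) β
  M-basis q = M-image.rank q , M-image.β q , M-image.image-basis q

  DividesImage : ℕ → ℤ → Set
  DividesImage q δ = ∀ x → InM K φ (suc q) x → ∃ λ z → InM K φ q z × (bd (suc q) x ≈ (δ ·c z))

  M-divisor : ∀ q → Σ ℤ λ δ → (δ ≡ 0ℤ ⊎ 1ℤ ℤ.< δ) × DividesImage q δ
  M-divisor q = common-divisor (M-submodule (suc q)) (M-submodule q) (M-diff-hom q) (snf q)
                  (proj₁ (proj₂ (M-basis (suc q)))) (proj₂ (proj₂ (M-basis (suc q))))
                  (proj₁ (proj₂ (M-basis q))) (proj₂ (proj₂ (M-basis q)))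

  -- An element of 𝓜 that bounds in K bounds in 𝓜: z = π z = π ∂c = ∂ π c.
  bounds-in-M : ∀ q z → InM K φ q z → Bdry K q z → ∃ λ x → InM K φ (suc q) x × (bd (suc q) x ≈ z)
  bounds-in-M q z Mz (c , Kc , z≈∂c) = π φ (suc q) c , (c , Kc , ≈-refl) ,
    ≈-sym (≈-trans (≈-sym (π-on-M q z Mz))
                   (≈-trans (IsHom.resp (π-hom q) _ _ (M-chain q z Mz) (bd-chain K q c Kc) z≈∂c) (π-bd q c Kc)))

  module _ (torsion-free : TorsionFreeHomology K) where

    module Descent q δ (δ≢0 : δ ≢ 0ℤ) (divisor : DividesImage q δ) where

      ScaledBoundary : ℤ → Chain n → Set
      ScaledBoundary k x = ∃ λ x' → InM K φ (suc q) x' × (bd (suc q) x ≈ (k ·c bd (suc q) x'))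

      -- If ∂x = δ z with z ∈ 𝓜, then z is a cycle (as δ ≠ 0) whose multiple
      -- δ z bounds; by torsion-freeness z bounds in K, hence in 𝓜.
      step : ∀ x → InM K φ (suc q) x → ScaledBoundary δ x
      step x Mx = from-divisor (divisor x Mx)
        where
        from-divisor : (∃ λ z → InM K φ q z × (bd (suc q) x ≈ (δ ·c z))) → ScaledBoundary δ x
        from-divisor (z , Mz , ∂x≈δz) = from-bound (bounds-in-M q z Mz
            (torsion-free q z (M-chain q z Mz , z-cycle) δ δ≢0 (x , M-chain (suc q) x Mx , ≈-sym ∂x≈δz)))
          where
          z-cycle : bd q z ≈ 0c
          z-cycle τ = [ (λ δ≡0 → ⊥-elim (δ≢0 δ≡0)) , (λ ∂zτ≡0 → ∂zτ≡0) ]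
            (i*j≡0⇒i≡0∨j≡0 δ (trans (sym (BdLinear.h-· q δ {z} tt τ))
                                    (trans (bd-resp q (≈-sym ∂x≈δz) τ) (bd∘bd q x τ))))
          from-bound : (∃ λ x' → InM K φ (suc q) x' × (bd (suc q) x' ≈ z)) → ScaledBoundary δ x
          from-bound (x' , Mx' , ∂x'≈z) = x' , Mx' , λ τ → trans (∂x≈δz τ) (cong (δ *_) (sym (∂x'≈z τ)))

      descent : ∀ N x → InM K φ (suc q) x → ScaledBoundary (δ ^ N) x
      descent zero    x Mx = x , Mx , λ τ → sym (*-identityˡ _)
      descent (suc N) x Mx = extend (descent N x Mx)
        where
        extend : ScaledBoundary (δ ^ N) x → ScaledBoundary (δ ^ suc N) x
        extend (x' , Mx' , ∂x≈δ^N∂x') = combine (step x' Mx')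
          where
          combine : ScaledBoundary δ x' → ScaledBoundary (δ ^ suc N) x
          combine (x'' , Mx'' , ∂x'≈δ∂x'') = x'' , Mx'' , λ τ → begin
            bd (suc q) x τ                   ≡⟨ ∂x≈δ^N∂x' τ ⟩
            δ ^ N * bd (suc q) x' τ          ≡⟨ cong (δ ^ N *_) (∂x'≈δ∂x'' τ) ⟩
            δ ^ N * (δ * bd (suc q) x'' τ)   ≡⟨ reassociate (δ ^ N) δ (bd (suc q) x'' τ) ⟩
            δ ^ suc N * bd (suc q) x'' τ     ∎
            where
            open ≡-Reasoning
            reassociate : ∀ a b c → a * (b * c) ≡ b * a * c
            reassociate = solve-∀

    -- The differential of 𝓜 vanishes: its image is divisible by δ^N for all N.
    M-bd-zero : ∀ q x → InM K φ (suc q) x → bd (suc q) x ≈ 0c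
    M-bd-zero q x Mx τ = vanish (M-divisor q)
      where
      vanish : Σ ℤ (λ δ → (δ ≡ 0ℤ ⊎ 1ℤ ℤ.< δ) × DividesImage q δ) → bd (suc q) x τ ≡ 0ℤ
      vanish (δ , inj₁ refl , divisor) = proj₂ (proj₂ (divisor x Mx)) τ
      vanish (δ , inj₂ 1<δ , divisor) = divisible-by-all-powers 1<δ (bd (suc q) x τ) λ N →
        divides (bd (suc q) (proj₁ (descent N x Mx)) τ)
                (trans (proj₂ (proj₂ (descent N x Mx)) τ) (*-comm (δ ^ N) _))
        where open Descent q δ (1<⇒≢0 1<δ) divisor

    M-cycle : ∀ q x → InM K φ q x → bd q x ≈ 0c
    M-cycle zero    x Mx τ = refl
    M-cycle (suc q) x Mx   = M-bd-zero q x Mx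

    -- Every cycle z is homologous to π z ∈ 𝓜, since z - π z = φ∂z + ∂φz = ∂φz.
    cycle-homologous : ∀ q z → Cycle K q z → Bdry K q (z -c π φ q z)
    cycle-homologous q z (Kz , ∂z≈0) = φ q z , IsHom.maps (φHom q) z Kz , λ σ →
      trans (sym (IsChainContraction.htpy π-contraction q z Kz σ))
            (trans (cong (_+ bd (suc q) (φ q z) σ) (φ∂-cycle q z Kz ∂z≈0 σ)) (+-identityˡ _))

    -- Elements of 𝓜 are homologous only if equal: x - y = ∂c gives
    -- x - y = π(x - y) = π ∂c = ∂ π c = 0.
    homologous⇒equal : ∀ q x y → InM K φ q x → InM K φ q y → Bdry K q (x -c y) → x ≈ y
    homologous⇒equal q x y Mx My (c , Kc , x-y≈∂c) σ = difference-zero (x σ) (y σ) (begin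
      x σ - y σ                        ≡⟨ sym (π-on-M q (x -c y) M[x-y] σ) ⟩
      π φ q (x -c y) σ                 ≡⟨ IsHom.resp (π-hom q) _ _ (M-chain q _ M[x-y]) (bd-chain K q c Kc) x-y≈∂c σ ⟩
      π φ q (bd (suc q) c) σ           ≡⟨ π-bd q c Kc σ ⟩
      bd (suc q) (π φ (suc q) c) σ     ≡⟨ M-bd-zero q (π φ (suc q) c) (c , Kc , ≈-refl) σ ⟩
      0ℤ                               ∎)
      where
      open ≡-Reasoning
      M[x-y] = P-- (M-submodule q) Mx My
      difference-zero : ∀ a b → a - b ≡ 0ℤ → a ≡ b
      difference-zero a b a-b≡0 = trans (sym (restore a b)) (trans (cong (_+ b) a-b≡0) (+-identityˡ b))
        where
        restore : ∀ a b → a - b + b ≡ a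
        restore = solve-∀

    M-homology-iso : IsHomologyIso K (𝓜 K φ) (λ q x → x)
    M-homology-iso = record
      { toCycle  = λ q x Mx → M-chain q x Mx , M-cycle q x Mx
      ; resp     = λ q x y _ _ x≈y → bounds-zero q (λ σ → trans (cong (_- y σ) (x≈y σ)) (+-inverseʳ (y σ)))
      ; additive = λ q x y _ _ → bounds-zero q (λ σ → +-inverseʳ (x σ + y σ))
      ; chainMap = λ q x Mx → x , M-chain (suc q) x Mx , ≈-refl
      ; inj      = homologous⇒equal
      ; surj     = λ q z cycle → π φ q z , (z , proj₁ cycle , ≈-refl) , cycle-homologous q z cycle }
      where
      bounds-zero : ∀ q {w} → w ≈ 0c → Bdry K q w
      bounds-zero q w≈0 = 0c , P-0 (chains K (suc q)) , ≈-trans w≈0 (≈-sym (BdLinear.h-0 (suc q)))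

mainTheorem1 : ∀ {n} (K : SimplicialComplex n) (C : ℕ → Σ ℕ λ r → Fin r → Chain n)
                 (φ : ℕ → Chain n → Chain n) → IsAMModel K C φ →
                 IsChainCx (𝓜 K φ)
                 × IsChainContraction (𝒞 K) (𝓜 K φ) (π φ) (λ q x → x) φ
                 × (∀ q → SNFCondition (InM K φ (suc q)) (InM K φ q) (bd (suc q)))
                 × (TorsionFreeHomology K → ∃ λ (h : ℕ → Chain n → Chain n) → IsHomologyIso K (𝓜 K φ) h)
mainTheorem1 K C φ am =
  M-is-chain-complex , π-contraction , snf , λ torsion-free → (λ q x → x) , M-homology-iso torsion-free
  where
  open IsAMModel am
  open Contraction K φ φHom φφ φ∂φ
  open AMModelHomology K C φ am
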